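{- Let $\Delta:\mathcal{A}\to\mathcal{A}\otimes\mathcal{A}$ be the linear map with $\Delta(|)=|\otimes|$ whose restriction to $\mathcal{A}^+$ is the unique tridendriform algebra morphism $\mathcal{A}^+\to\mathcal{A}\overline{\otimes}\mathcal{A}$ with $\Delta(Y)=Y\otimes|+|\otimes Y$. Then for every reduced tree $t\neq|$, $$\Delta(t)=\sum_{c\text{ admissible cut of }t}G^c(t)\otimes P^c(t).$$
   Context: Tridendriform algebra: vector space with bilinear $\prec,\cdot,\succ$ such that, with $*=\prec+\cdot+\succ$: $(a\prec b)\prec c=a\prec(b*c)$, $(a\succ b)\prec c=a\succ(b\prec c)$, $(a*b)\succ c=a\succ(b\succ c)$, $(a\succ b)\cdot c=a\succ(b\cdot c)$, $(a\prec b)\cdot c=a\cdot(b\succ c)$, $(a\cdot b)\prec c=a\cdot(b\prec c)$, $(a\cdot b)\cdot c=a\cdot(b\cdot c)$. A reduced tree is a planar rooted tree (drawn with a root edge below the root, leaves as top edges) whose internal vertices all have at least two children; $|$ is the tree with one leaf and no internal vertex. $T_n$ = reduced trees with $n+1$ leaves, $\mathcal{A}=\bigoplus_{n\ge0}\mathbb{K}T_n$, $\mathcal{A}^+=\bigoplus_{n\ge1}\mathbb{K}T_n$. For trees $x^{(0)},\dots,x^{(k)}$ ($k\ge1$), $x^{(0)}\vee\cdots\vee x^{(k)}$ grafts them left to right on a new root (multilinear); $Y=|\vee|$. For $x=x^{(0)}\vee\cdots\vee x^{(k)}$, $y=y^{(0)}\vee\cdots\vee y^{(l)}$: $x\prec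 y=x^{(0)}\vee\cdots\vee x^{(k-1)}\vee(x^{(k)}*y)$, $x\cdot y=x^{(0)}\vee\cdots\vee x^{(k-1)}\vee(x^{(k)}*y^{(0)})\vee y^{(1)}\vee\cdots\vee y^{(l)}$, $x\succ y=(x*y^{(0)})\vee y^{(1)}\vee\cdots\vee y^{(l)}$, recursively, with $*=\prec+\cdot+\succ$ and $|$ a unit for $*$; $\mathcal{A}^+$ is then the free tridendriform algebra on $Y$. Conventions for $a\in\mathcal{A}^+$: $|\prec a=0$, $a\prec|=a$, $|\succ a=a$, $a\succ|=0$, $|\cdot a=a\cdot|=0$. On $\mathcal{A}\otimes\mathcal{A}$ (minus $|\otimes|$ as augmentation ideal) for trees: $(a\otimes b)\ltimes(c\otimes d)=(a*c)\otimes(b\ltimes d)$ if $b\ne|$ or $d\ne|$, and $(a\otimes|)\ltimes(c\otimes|)=(a\ltimes c)\otimes|$; this is a tridendriform algebra $\mathcal{A}\overline{\otimes}\mathcal{A}$. Cuts: an internal edge of $t$ is an edge joining two internal vertices. An admissible cut of $t$ is either a nonempty set $c$ of internal edges such that every path from the root to a leaf contains at most one edge of $c$, or the empty cut, or the total cut. For a nonempty non-total admissible cut $c$ with $m$ edges, removing the edges of $c$ leaves $m$ subtrees not containing the root (each cut edge becoming the root edge of its subtree), denoted $G^c_1(t),\dots,G^c_m(t)$ from left to right, and the component containing the root, $P^c(t)$ (each cut edge becoming a leaf); $G^c(t)=G^c_1(t)*\cdots*G^c_m(t)$. For the empty cut, $P^c(t)=t$, $G^c(t)=|$; for the total cut,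 $P^c(t)=|$, $G^c(t)=t$. -}

module Defs where

open import Level using (Level; _⊔_; suc)
open import Algebra.Bundles using (CommutativeRing)
open import Data.Bool using (Bool; true; false; _∧_; _∨_; not; if_then_else_)
open import Data.Nat as ℕ using (ℕ; zero; _≡ᵇ_; _≤ᵇ_)
import Data.Nat
open import Data.List using (List; []; _∷_; _++_; map; concat; concatMap; foldr; filter; length; null)
open import Data.Maybe using (Maybe; just; nothing; fromMaybe)
open import Data.Product using (_×_; _,_; Σ; ∃)
open import Relation.Nullary using (¬_)
open import Relation.Binary.PropositionalEquality using (_≡_)

record Field (c ℓ : Level) : Set (Level.suc (c ⊔ ℓ)) where
  field
    commutativeRing : CommutativeRing c ℓ
  open CommutativeRing commutativeRing public
  field
    0≉1 : ¬ (0# ≈ 1#)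
    inverse : ∀ x → ¬ (x ≈ 0#) → ∃ λ y → (x * y) ≈ 1#

-- Reduced planar rooted trees.
-- `leaf` is the tree | ; `node a m l` is the grafting a ∨ m₁ ∨ … ∨ mⱼ ∨ l
-- (children from left to right: a, then the list m, then l), so every
-- internal vertex has at least two children.

data Tree : Set where
  leaf : Tree
  node : Tree → List Tree → Tree → Tree

Y : Tree
Y = node leaf [] leaf

mutual
  eqT : Tree → Tree → Bool
  eqT leaf leaf = true
  eqT leaf (node _ _ _) = false
  eqT (node _ _ _) leaf = false
  eqT (node a m l) (node a' m' l') = eqT a a' ∧ eqTs m m' ∧ eqT l l'

  eqTs : List Tree → List Tree → Bool
  eqTs [] [] = true
  eqTs [] (_ ∷ _) = false
  eqTs (_ ∷ _) [] = false
  eqTs (x ∷ xs) (y ∷ ys) = eqT x y ∧ eqTs xs ys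

-- All structure constants are 1, so
-- x ⋉ y is returned as the list of trees (with multiplicity) whose sum it is.
-- Conventions for |: | * y = y, x * | = x, |≺a = 0, a≺| = a, |≻a = a,
-- a≻| = 0, |·a = a·| = 0.

mutual
  _*T_ : Tree → Tree → List Tree
  leaf *T y = y ∷ []
  node a m l *T leaf = node a m l ∷ []
  node a m l *T node a' m' l' =
    (node a m l ≺T node a' m' l') ++ (node a m l ·T node a' m' l')
      ++ (node a m l ≻T node a' m' l')

  _≺T_ : Tree → Tree → List Tree
  leaf ≺T y = []
  node a m l ≺T y = map (node a m) (l *T y)

  _≻T_ : Tree → Tree → List Tree
  x ≻T leaf = []
  x ≻T node a' m' l' = map (λ t → node t m' l') (x *T a')

  _·T_ : Tree → Tree → List Tree
  leaf ·T y = []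
  node a m l ·T leaf = []
  node a m l ·T node a' m' l' = map (λ t → node a (m ++ (t ∷ m')) l') (l *T a')

-- Operations on A ⊗ A on basis tensors (the algebra A ⊗̄ A):
-- (a⊗b) ⋉ (c⊗d) = (a*c)⊗(b⋉d) if b ≠ | or d ≠ |, (a⊗|) ⋉ (c⊗|) = (a⋉c)⊗|.

tensOp : (Tree → Tree → List Tree) → Tree × Tree → Tree × Tree → List (Tree × Tree)
tensOp op (a , leaf) (c , leaf) = map (λ s → s , leaf) (op a c)
tensOp op (a , b) (c , d) = concatMap (λ s → map (λ u → s , u) (op b d)) (a *T c)

-- A vertex (internal vertex or leaf edge) of a tree is addressed by the list
-- of child indices (0-based, left to right) on the path from the root.
-- An edge below the root is identified with the address of its upper end;
-- it is internal iff its upper end is an internal vertex (its lower end is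
-- always internal).  The root edge has address [] and is never internal.

filterB : {A : Set} → (A → Bool) → List A → List A
filterB p [] = []
filterB p (x ∷ xs) = if p x then x ∷ filterB p xs else filterB p xs

Addr : Set
Addr = List ℕ

lookupL : ℕ → List Tree → Maybe Tree
lookupL i [] = nothing
lookupL zero (x ∷ xs) = just x
lookupL (ℕ.suc i) (x ∷ xs) = lookupL i xs

children : Tree → List Tree
children leaf = []
children (node a m l) = a ∷ (m ++ (l ∷ []))

subtreeAt : Addr → Tree → Maybe Tree
subtreeAt [] t = just t
subtreeAt (i ∷ p) t with lookupL i (children t)
... | nothing = nothing
... | just s = subtreeAt p s

modL : (Tree → Tree) → ℕ → List Tree → List Tree
modL f i [] = []
modL f zero (x ∷ xs) = f x ∷ xs
modL f (ℕ.suc i) (x ∷ xs) = x ∷ modL f i xs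

prune : Addr → Tree → Tree
prune [] t = leaf
prune (i ∷ p) leaf = leaf
prune (zero ∷ p) (node a m l) = node (prune p a) m l
prune (ℕ.suc j ∷ p) (node a m l) =
  node a (modL (prune p) j m) (if j ≡ᵇ length m then prune p l else l)

mutual
  addrs : Tree → List Addr
  addrs leaf = [] ∷ []
  addrs (node a m l) =
    [] ∷ (map (0 ∷_) (addrs a) ++ addrsL 1 m ++ map (ℕ.suc (length m) ∷_) (addrs l))

  addrsL : ℕ → List Tree → List Addr
  addrsL i [] = []
  addrsL i (x ∷ xs) = map (i ∷_) (addrs x) ++ addrsL (ℕ.suc i) xs

isNodeM : Maybe Tree → Bool
isNodeM (just (node _ _ _)) = true
isNodeM _ = false

isLeafM : Maybe Tree → Bool
isLeafM (just leaf) = true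
isLeafM _ = false

-- internal edges of t, in preorder (= left-to-right order on antichains)
internalEdges : Tree → List Addr
internalEdges t = filterB (λ p → not (null p) ∧ isNodeM (subtreeAt p t)) (addrs t)

leafAddrs : Tree → List Addr
leafAddrs t = filterB (λ p → isLeafM (subtreeAt p t)) (addrs t)

isPrefix : Addr → Addr → Bool
isPrefix [] q = true
isPrefix (i ∷ p) [] = false
isPrefix (i ∷ p) (j ∷ q) = (i ≡ᵇ j) ∧ isPrefix p q

-- the path from the root to the leaf at address q contains edge p
-- iff p is a prefix of q
countOnPath : List Addr → Addr → ℕ
countOnPath c q = length (filterB (λ p → isPrefix p q) c)

admissibleB : Tree → List Addr → Bool
admissibleB t c = foldr (λ q b → (countOnPath c q ≤ᵇ 1) ∧ b) true (leafAddrs t)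

-- all sublists (= subsets, the edge list having no repetitions)
sublists : {A : Set} → List A → List (List A)
sublists [] = [] ∷ []
sublists (x ∷ xs) = map (x ∷_) (sublists xs) ++ sublists xs

-- nonempty, non-total admissible cuts (sets of internal edges)
properCuts : Tree → List (List Addr)
properCuts t = filterB (λ c → not (null c) ∧ admissibleB t c) (sublists (internalEdges t))

Pc : List Addr → Tree → Tree
Pc c t = foldr prune t c

Gs : List Addr → Tree → List Tree
Gs c t = map (λ p → fromMaybe leaf (subtreeAt p t)) c

prodT : List Tree → List Tree
prodT [] = leaf ∷ []
prodT (g ∷ gs) = concatMap (λ h → g *T h) (prodT gs)

-- the terms G^c(t) ⊗ P^c(t), over all admissible cuts:
-- empty cut (| ⊗ t), total cut (t ⊗ |), and the proper ones
cutTerms : Tree → List (Tree × Tree)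
cutTerms t = (leaf , t) ∷ (t , leaf) ∷
  concatMap (λ c → map (λ g → g , Pc c t) (prodT (Gs c t))) (properCuts t)

-- Free K-modules on trees and on pairs of trees (A and A ⊗ A), as finite
-- formal linear combinations, compared coefficientwise.

module Linear {c ℓ : Level} (K : Field c ℓ) where
  open Field K renaming (Carrier to Kc)

  V : Set c
  V = List (Kc × Tree)

  V₂ : Set c
  V₂ = List (Kc × Tree × Tree)

  coeff₂ : V₂ → Tree → Tree → Kc
  coeff₂ [] a b = 0#
  coeff₂ ((r , a' , b') ∷ v) a b =
    (if eqT a a' ∧ eqT b b' then r else 0#) + coeff₂ v a b

  infix 4 _≈₂_
  _≈₂_ : V₂ → V₂ → Set ℓ
  v ≈₂ w = ∀ a b → coeff₂ v a b ≈ coeff₂ w a b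

  lift : List Tree → V
  lift = map (λ t → 1# , t)

  lift₂ : List (Tree × Tree) → V₂
  lift₂ = map (λ { (a , b) → 1# , a , b })

  scale₂ : Kc → V₂ → V₂
  scale₂ r = map (λ { (s , a , b) → r * s , a , b })

  ext₂ : (Tree × Tree → Tree × Tree → List (Tree × Tree)) → V₂ → V₂ → V₂
  ext₂ f v w = concatMap (λ { (r , a , b) →
                 concatMap (λ { (s , c , d) → scale₂ (r * s) (lift₂ (f (a , b) (c , d))) }) w }) v

  linExt : (Tree → V₂) → V → V₂
  linExt δ v = concatMap (λ { (r , t) → scale₂ r (δ t) }) v

  record IsCoproductMorphism (δ : Tree → V₂) : Set (c ⊔ ℓ) where
    field
      onY : δ Y ≈₂ ((1# , Y , leaf) ∷ (1# , leaf , Y) ∷ [])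
      pres-≺ : ∀ x y → ¬ (x ≡ leaf) → ¬ (y ≡ leaf) →
               linExt δ (lift (x ≺T y)) ≈₂ ext₂ (tensOp _≺T_) (δ x) (δ y)
      pres-· : ∀ x y → ¬ (x ≡ leaf) → ¬ (y ≡ leaf) →
               linExt δ (lift (x ·T y)) ≈₂ ext₂ (tensOp _·T_) (δ x) (δ y)
      pres-≻ : ∀ x y → ¬ (x ≡ leaf) → ¬ (y ≡ leaf) →
               linExt δ (lift (x ≻T y)) ≈₂ ext₂ (tensOp _≻T_) (δ x) (δ y)

  cutSum : Tree → V₂
  cutSum t = lift₂ (cutTerms t)

{-# OPTIONS --safe #-}

-- A tree t ≠ | other than Y decomposes as
--   t = (a ∨ m₁) · (| ∨ m₂ ∨ ⋯ ∨ l)   if t = a ∨ m₁ ∨ m₂ ∨ ⋯ ∨ l has at least three children,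
--   t = (a ∨ |) ≺ l                    if t = a ∨ l with l ≠ |,
--   t = a ≻ Y                          if t = a ∨ | with a ≠ |,
-- each time into strictly smaller trees. Since Δ is a morphism with the given
-- Δ(Y), by induction on the size it suffices that the cut sums satisfy the
-- same three identities. For this, an admissible cut of a node other than the
-- total cut is an independent choice, for each child, of either the edge
-- joining it to the root or an admissible cut of the child. The cut-off trees
-- then multiply (using the associativity of *) and the remaining parts are
-- regrafted on the root, which is how ⋉ acts on A ⊗̄ A away from | ⊗ |. All
-- these sums have coefficients in ℕ, so they are compared as multisets of
-- basis tensors and only passed to K at the end.

module Submission where

open import Defs
open import Level using (Level)
open import Relation.Nullary using (¬_)
open import Relation.Binary.PropositionalEquality using (_≡_)

module CutSums where

  open import Algebra.Properties.CommutativeSemigroup using (interchange)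
  open import Data.Bool using (Bool; true; false; _∧_; not; if_then_else_; T)
  open import Data.Bool.Properties using (∧-assoc)
  open import Data.Empty using (⊥-elim)
  open import Data.Unit using (tt)
  open import Data.Nat using (ℕ; zero; suc; _+_; _≡ᵇ_; _≤ᵇ_; _≤_; _<_)
  open import Data.Nat.Properties as ℕₚ using (+-comm; +-assoc; +-identityʳ; +-suc; +-commutativeSemigroup)
  open import Data.List using (List; []; _∷_; _++_; map; concatMap; length; null; foldr)
  open import Data.List.Properties using (++-assoc; ++-identityʳ; map-++; map-∘; map-cong; map-cong-local; map-id; foldr-++; length-++; length-map)
  open import Data.List.Relation.Unary.All as All using (All; []; _∷_)
  import Data.List.Relation.Unary.All.Properties as Allₚ
  open import Data.List.Relation.Unary.Any as Any using (Any; here; there)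
  import Data.List.Relation.Unary.Any.Properties as Anyₚ
  open import Data.List.Membership.Propositional using (_∈_)
  open import Data.Maybe using (Maybe; just; fromMaybe)
  open import Data.Product using (_×_; _,_; proj₁; proj₂)
  open import Function using (_∘_)
  open import Relation.Binary.PropositionalEquality
  open ≡-Reasoning

  -- Lists and their equality as multisets

  private
    variable
      A B C : Set

  Σℕ : (A → ℕ) → List A → ℕ
  Σℕ φ []       = 0
  Σℕ φ (x ∷ xs) = φ x + Σℕ φ xs

  -- Two lists are equal as multisets iff every ℕ-valued weight has the same
  -- total on both; this turns all rearrangements into arithmetic on sums.
  infix 4 _≋_
  record _≋_ (xs ys : List A) : Set where
    constructor mk≋
    field Σℕ-≡ : ∀ φ → Σℕ φ xs ≡ Σℕ φ ys
  open _≋_ public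

  ≋-refl : {xs : List A} → xs ≋ xs
  ≋-refl = mk≋ λ _ → refl

  ≋-reflexive : {xs ys : List A} → xs ≡ ys → xs ≋ ys
  ≋-reflexive refl = ≋-refl

  ≋-sym : {xs ys : List A} → xs ≋ ys → ys ≋ xs
  ≋-sym p = mk≋ λ φ → sym (Σℕ-≡ p φ)

  ≋-trans : {xs ys zs : List A} → xs ≋ ys → ys ≋ zs → xs ≋ zs
  ≋-trans p q = mk≋ λ φ → trans (Σℕ-≡ p φ) (Σℕ-≡ q φ)

  Σℕ-++ : ∀ φ (xs ys : List A) → Σℕ φ (xs ++ ys) ≡ Σℕ φ xs + Σℕ φ ys
  Σℕ-++ φ []       ys = refl
  Σℕ-++ φ (x ∷ xs) ys = trans (cong (φ x +_) (Σℕ-++ φ xs ys)) (sym (+-assoc (φ x) _ _))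

  Σℕ-cong : {φ ψ : A → ℕ} → (∀ x → φ x ≡ ψ x) → ∀ xs → Σℕ φ xs ≡ Σℕ ψ xs
  Σℕ-cong e []       = refl
  Σℕ-cong e (x ∷ xs) = cong₂ _+_ (e x) (Σℕ-cong e xs)

  Σℕ-+ : ∀ (φ ψ : A → ℕ) xs → Σℕ (λ x → φ x + ψ x) xs ≡ Σℕ φ xs + Σℕ ψ xs
  Σℕ-+ φ ψ []       = refl
  Σℕ-+ φ ψ (x ∷ xs) = trans (cong (φ x + ψ x +_) (Σℕ-+ φ ψ xs))
                            (interchange +-commutativeSemigroup (φ x) (ψ x) _ _)

  Σℕ-zero : ∀ (xs : List A) → Σℕ (λ _ → 0) xs ≡ 0
  Σℕ-zero []       = refl
  Σℕ-zero (x ∷ xs) = Σℕ-zero xs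

  ≋-++⁺ : {xs xs′ ys ys′ : List A} → xs ≋ xs′ → ys ≋ ys′ → xs ++ ys ≋ xs′ ++ ys′
  ≋-++⁺ {xs = xs} {xs′} {ys} {ys′} p q = mk≋ λ φ → begin
    Σℕ φ (xs ++ ys)     ≡⟨ Σℕ-++ φ xs ys ⟩
    Σℕ φ xs + Σℕ φ ys   ≡⟨ cong₂ _+_ (Σℕ-≡ p φ) (Σℕ-≡ q φ) ⟩
    Σℕ φ xs′ + Σℕ φ ys′ ≡⟨ Σℕ-++ φ xs′ ys′ ⟨
    Σℕ φ (xs′ ++ ys′)   ∎

  ≋-++-comm : ∀ (xs ys : List A) → xs ++ ys ≋ ys ++ xs
  ≋-++-comm xs ys = mk≋ λ φ →
    trans (Σℕ-++ φ xs ys) (trans (+-comm (Σℕ φ xs) _) (sym (Σℕ-++ φ ys xs)))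

  ≋-++-identityʳ : ∀ (xs : List A) → xs ++ [] ≋ xs
  ≋-++-identityʳ xs = ≋-reflexive (++-identityʳ xs)

  ≋-swap : ∀ (x y : A) xs → x ∷ y ∷ xs ≋ y ∷ x ∷ xs
  ≋-swap x y xs = mk≋ λ φ →
    trans (sym (+-assoc (φ x) (φ y) _)) (trans (cong (_+ Σℕ φ xs) (+-comm (φ x) (φ y))) (+-assoc (φ y) (φ x) _))

  Σℕ-map : ∀ (φ : B → ℕ) (f : A → B) xs → Σℕ φ (map f xs) ≡ Σℕ (λ x → φ (f x)) xs
  Σℕ-map φ f []       = refl
  Σℕ-map φ f (x ∷ xs) = cong (φ (f x) +_) (Σℕ-map φ f xs)

  Σℕ-concatMap : ∀ (φ : B → ℕ) (f : A → List B) xs →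
                 Σℕ φ (concatMap f xs) ≡ Σℕ (λ x → Σℕ φ (f x)) xs
  Σℕ-concatMap φ f []       = refl
  Σℕ-concatMap φ f (x ∷ xs) =
    trans (Σℕ-++ φ (f x) (concatMap f xs)) (cong (Σℕ φ (f x) +_) (Σℕ-concatMap φ f xs))

  Σℕ-comm : ∀ (φ : A → B → ℕ) xs ys →
            Σℕ (λ x → Σℕ (φ x) ys) xs ≡ Σℕ (λ y → Σℕ (λ x → φ x y) xs) ys
  Σℕ-comm φ []       ys = sym (Σℕ-zero ys)
  Σℕ-comm φ (x ∷ xs) ys = trans (cong (Σℕ (φ x) ys +_) (Σℕ-comm φ xs ys))
                                (sym (Σℕ-+ (φ x) (λ y → Σℕ (λ x′ → φ x′ y) xs) ys))

  ≋-map⁺ : (f : A → B) {xs ys : List A} → xs ≋ ys → map f xs ≋ map f ys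
  ≋-map⁺ f {xs = xs} {ys} p = mk≋ λ φ →
    trans (Σℕ-map φ f xs) (trans (Σℕ-≡ p (λ x → φ (f x))) (sym (Σℕ-map φ f ys)))

  ≋-concatMap⁺ : (f : A → List B) {xs ys : List A} → xs ≋ ys → concatMap f xs ≋ concatMap f ys
  ≋-concatMap⁺ f {xs = xs} {ys} p = mk≋ λ φ →
    trans (Σℕ-concatMap φ f xs) (trans (Σℕ-≡ p (λ x → Σℕ φ (f x))) (sym (Σℕ-concatMap φ f ys)))

  ≋-concatMap-cong : {f g : A → List B} → (∀ x → f x ≋ g x) → ∀ xs → concatMap f xs ≋ concatMap g xs
  ≋-concatMap-cong {f = f} {g} e xs = mk≋ λ φ →
    trans (Σℕ-concatMap φ f xs)
      (trans (Σℕ-cong (λ x → Σℕ-≡ (e x) φ) xs) (sym (Σℕ-concatMap φ g xs)))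

  ≋-concatMap-cong-local : {f g : A → List B} {P : A → Set} → (∀ {x} → P x → f x ≋ g x) →
                           ∀ {xs} → All P xs → concatMap f xs ≋ concatMap g xs
  ≋-concatMap-cong-local e []       = ≋-refl
  ≋-concatMap-cong-local e (p ∷ ps) = ≋-++⁺ (e p) (≋-concatMap-cong-local e ps)

  ≋-concatMap-++ : ∀ (f : A → List B) xs ys → concatMap f (xs ++ ys) ≋ concatMap f xs ++ concatMap f ys
  ≋-concatMap-++ f xs ys = ≋-reflexive (Data.List.Properties.concatMap-++ f xs ys)
    where import Data.List.Properties

  ≋-concatMap-split : ∀ (f g : A → List B) xs →
                      concatMap (λ x → f x ++ g x) xs ≋ concatMap f xs ++ concatMap g xs
  ≋-concatMap-split f g xs = mk≋ λ φ → begin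
    Σℕ φ (concatMap (λ x → f x ++ g x) xs)                 ≡⟨ Σℕ-concatMap φ _ xs ⟩
    Σℕ (λ x → Σℕ φ (f x ++ g x)) xs                        ≡⟨ Σℕ-cong (λ x → Σℕ-++ φ (f x) (g x)) xs ⟩
    Σℕ (λ x → Σℕ φ (f x) + Σℕ φ (g x)) xs                  ≡⟨ Σℕ-+ _ _ xs ⟩
    Σℕ (λ x → Σℕ φ (f x)) xs + Σℕ (λ x → Σℕ φ (g x)) xs    ≡⟨ cong₂ _+_ (Σℕ-concatMap φ f xs) (Σℕ-concatMap φ g xs) ⟨
    Σℕ φ (concatMap f xs) + Σℕ φ (concatMap g xs)          ≡⟨ Σℕ-++ φ (concatMap f xs) _ ⟨
    Σℕ φ (concatMap f xs ++ concatMap g xs)                ∎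

  ≋-concatMap-singleton : ∀ (f : A → B) xs → concatMap (λ x → f x ∷ []) xs ≋ map f xs
  ≋-concatMap-singleton f xs = mk≋ λ φ →
    trans (Σℕ-concatMap φ _ xs) (trans (Σℕ-cong (λ x → +-identityʳ (φ (f x))) xs) (sym (Σℕ-map φ f xs)))

  ≋-concatMap-empty : ∀ (xs : List A) → concatMap (λ _ → []) xs ≋ ([] {A = B})
  ≋-concatMap-empty xs = mk≋ λ φ → trans (Σℕ-concatMap φ _ xs) (Σℕ-zero xs)

  ≋-concatMap-comm : (f : A → B → List C) → ∀ xs ys →
    concatMap (λ x → concatMap (f x) ys) xs ≋ concatMap (λ y → concatMap (λ x → f x y) xs) ys
  ≋-concatMap-comm f xs ys = mk≋ λ φ → begin
    Σℕ φ (concatMap (λ x → concatMap (f x) ys) xs)         ≡⟨ Σℕ-concatMap φ _ xs ⟩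
    Σℕ (λ x → Σℕ φ (concatMap (f x) ys)) xs                ≡⟨ Σℕ-cong (λ x → Σℕ-concatMap φ (f x) ys) xs ⟩
    Σℕ (λ x → Σℕ (λ y → Σℕ φ (f x y)) ys) xs               ≡⟨ Σℕ-comm (λ x y → Σℕ φ (f x y)) xs ys ⟩
    Σℕ (λ y → Σℕ (λ x → Σℕ φ (f x y)) xs) ys               ≡⟨ Σℕ-cong (λ y → Σℕ-concatMap φ (λ x → f x y) xs) ys ⟨
    Σℕ (λ y → Σℕ φ (concatMap (λ x → f x y) xs)) ys        ≡⟨ Σℕ-concatMap φ _ ys ⟨
    Σℕ φ (concatMap (λ y → concatMap (λ x → f x y) xs) ys) ∎

  ≋-map-comm : (f : A → B → C) → ∀ xs ys →
    concatMap (λ x → map (f x) ys) xs ≋ concatMap (λ y → map (λ x → f x y) xs) ys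
  ≋-map-comm f xs ys =
    ≋-trans (≋-concatMap-cong (λ x → ≋-sym (≋-concatMap-singleton (f x) ys)) xs)
    (≋-trans (≋-concatMap-comm (λ x y → f x y ∷ []) xs ys)
             (≋-concatMap-cong (λ y → ≋-concatMap-singleton (λ x → f x y) xs) ys))

  ≋-concatMap-map : ∀ (f : B → List C) (g : A → B) xs → concatMap f (map g xs) ≋ concatMap (λ x → f (g x)) xs
  ≋-concatMap-map f g xs = ≋-reflexive (Data.List.Properties.concatMap-map f g xs)
    where import Data.List.Properties

  ≋-map-concatMap : ∀ (f : B → C) (g : A → List B) xs → map f (concatMap g xs) ≋ concatMap (λ x → map f (g x)) xs
  ≋-map-concatMap f g xs = mk≋ λ φ →
    trans (Σℕ-map φ f (concatMap g xs)) (trans (Σℕ-concatMap _ g xs)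
      (trans (Σℕ-cong (λ x → sym (Σℕ-map φ f (g x))) xs) (sym (Σℕ-concatMap φ _ xs))))

  ≋-concatMap-concatMap : ∀ (f : B → List C) (g : A → List B) xs →
    concatMap f (concatMap g xs) ≋ concatMap (λ x → concatMap f (g x)) xs
  ≋-concatMap-concatMap f g xs = mk≋ λ φ →
    trans (Σℕ-concatMap φ f (concatMap g xs)) (trans (Σℕ-concatMap _ g xs)
      (trans (Σℕ-cong (λ x → sym (Σℕ-concatMap φ f (g x))) xs) (sym (Σℕ-concatMap φ _ xs))))

  ≋-concatMap-pure : (xs : List A) → concatMap (λ x → x ∷ []) xs ≋ xs
  ≋-concatMap-pure xs = ≋-trans (≋-concatMap-singleton (λ x → x) xs) (≋-reflexive (map-id xs))

  filterB-++ : ∀ (p : A → Bool) xs ys → filterB p (xs ++ ys) ≡ filterB p xs ++ filterB p ys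
  filterB-++ p []       ys = refl
  filterB-++ p (x ∷ xs) ys with p x
  ... | true  = cong (x ∷_) (filterB-++ p xs ys)
  ... | false = filterB-++ p xs ys

  filterB-map : ∀ (p : B → Bool) (f : A → B) xs → filterB p (map f xs) ≡ map f (filterB (λ x → p (f x)) xs)
  filterB-map p f []       = refl
  filterB-map p f (x ∷ xs) with p (f x)
  ... | true  = cong (f x ∷_) (filterB-map p f xs)
  ... | false = filterB-map p f xs

  filterB-cong-local : {p q : A → Bool} {xs : List A} → All (λ x → p x ≡ q x) xs → filterB p xs ≡ filterB q xs
  filterB-cong-local                   []       = refl
  filterB-cong-local {q = q} {x ∷ xs} (e ∷ es) rewrite e with q x
  ... | true  = cong (x ∷_) (filterB-cong-local es)
  ... | false = filterB-cong-local es

  filterB-cong : {p q : A → Bool} → (∀ x → p x ≡ q x) → ∀ xs → filterB p xs ≡ filterB q xs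
  filterB-cong e xs = filterB-cong-local {xs = xs} (All.tabulate (λ {x} _ → e x))

  filterB-All : {P : A → Set} (p : A → Bool) {xs : List A} → All P xs → All P (filterB p xs)
  filterB-All p                []         = []
  filterB-All p {x ∷ xs} (px ∷ ps) with p x
  ... | true  = px ∷ filterB-All p ps
  ... | false = filterB-All p ps

  allB : (A → Bool) → List A → Bool
  allB f = foldr (λ q b → f q ∧ b) true

  allB-++ : ∀ (f : A → Bool) xs ys → allB f (xs ++ ys) ≡ allB f xs ∧ allB f ys
  allB-++ f []       ys = refl
  allB-++ f (x ∷ xs) ys = trans (cong (f x ∧_) (allB-++ f xs ys)) (sym (∧-assoc (f x) _ _))

  allB-map : ∀ (f : B → Bool) (g : A → B) xs → allB f (map g xs) ≡ allB (λ x → f (g x)) xs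
  allB-map f g []       = refl
  allB-map f g (x ∷ xs) = cong (f (g x) ∧_) (allB-map f g xs)

  allB-cong : {f g : A → Bool} → (∀ x → f x ≡ g x) → ∀ xs → allB f xs ≡ allB g xs
  allB-cong e []       = refl
  allB-cong e (x ∷ xs) = cong₂ _∧_ (e x) (allB-cong e xs)

  Σℕ-filterB : ∀ (p : A → Bool) φ xs → Σℕ φ (filterB p xs) ≡ Σℕ (λ x → if p x then φ x else 0) xs
  Σℕ-filterB p φ []       = refl
  Σℕ-filterB p φ (x ∷ xs) with p x
  ... | true  = cong (φ x +_) (Σℕ-filterB p φ xs)
  ... | false = Σℕ-filterB p φ xs

  ≋-filterB⁺ : ∀ (p : A → Bool) {xs ys} → xs ≋ ys → filterB p xs ≋ filterB p ys
  ≋-filterB⁺ p {xs} {ys} e = mk≋ λ φ →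
    trans (Σℕ-filterB p φ xs) (trans (Σℕ-≡ e _) (sym (Σℕ-filterB p φ ys)))

  filterB-concatMap : ∀ (p : B → Bool) (f : A → List B) xs →
                      filterB p (concatMap f xs) ≡ concatMap (λ x → filterB p (f x)) xs
  filterB-concatMap p f []       = refl
  filterB-concatMap p f (x ∷ xs) =
    trans (filterB-++ p (f x) (concatMap f xs)) (cong (filterB p (f x) ++_) (filterB-concatMap p f xs))

  concatMap-filterB : ∀ (p : A → Bool) (f : A → List B) xs →
                      concatMap f (filterB p xs) ≡ concatMap (λ x → if p x then f x else []) xs
  concatMap-filterB p f []       = refl
  concatMap-filterB p f (x ∷ xs) with p x
  ... | true  = cong (f x ++_) (concatMap-filterB p f xs)
  ... | false = concatMap-filterB p f xs

  filterB-∧ : ∀ b (q : A → Bool) xs → filterB (λ y → b ∧ q y) xs ≡ (if b then filterB q xs else [])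
  filterB-∧ true  q xs       = refl
  filterB-∧ false q []       = refl
  filterB-∧ false q (x ∷ xs) = filterB-∧ false q xs

  map-if : ∀ b (f : A → B) xs → map f (if b then xs else []) ≡ (if b then map f xs else [])
  map-if true  f xs = refl
  map-if false f xs = refl

  ≋-if : ∀ b {xs ys : List A} → xs ≋ ys → (if b then xs else []) ≋ (if b then ys else [])
  ≋-if true  e = e
  ≋-if false e = ≋-refl

  allB-true : ∀ (xs : List A) → allB (λ _ → true) xs ≡ true
  allB-true []       = refl
  allB-true (x ∷ xs) = allB-true xs

  allB-false : ∀ (f : A → Bool) {xs} → Any (λ q → f q ≡ false) xs → allB f xs ≡ false
  allB-false f (here e) rewrite e = refl
  allB-false f {x ∷ _} (there h) with f x
  ... | true  = allB-false f h
  ... | false = refl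

  sublists-⊆ : ∀ (xs : List A) → All (All (_∈ xs)) (sublists xs)
  sublists-⊆ []       = [] ∷ []
  sublists-⊆ (x ∷ xs) = Allₚ.++⁺ (Allₚ.map⁺ (All.map (λ ys → here refl ∷ All.map there ys) (sublists-⊆ xs)))
                                 (All.map (All.map there) (sublists-⊆ xs))

  filterB-⊆ : ∀ (p : A → Bool) {x} xs → x ∈ filterB p xs → x ∈ xs
  filterB-⊆ p (y ∷ xs) x∈ with p y
  filterB-⊆ p (y ∷ xs) (here e)  | true = here e
  filterB-⊆ p (y ∷ xs) (there x∈) | true = there (filterB-⊆ p xs x∈)
  ... | false = there (filterB-⊆ p xs x∈)

  filterB-null-sublists : ∀ (xs : List A) → filterB null (sublists xs) ≡ [] ∷ []
  filterB-null-sublists []       = refl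
  filterB-null-sublists (x ∷ xs) =
    trans (filterB-++ null (map (x ∷_) (sublists xs)) (sublists xs))
    (trans (cong (_++ filterB null (sublists xs))
             (trans (filterB-map null (x ∷_) (sublists xs)) (cong (map (x ∷_)) (filterB-false (sublists xs)))))
           (filterB-null-sublists xs))
    where
    filterB-false : ∀ (ys : List (List A)) → filterB (λ _ → false) ys ≡ []
    filterB-false []       = refl
    filterB-false (_ ∷ ys) = filterB-false ys

  filterB-split : ∀ (p q : A → Bool) xs → filterB p xs ≋ filterB (λ d → not (q d) ∧ p d) xs ++ filterB (λ d → q d ∧ p d) xs
  filterB-split p q xs = mk≋ λ φ →
    trans (Σℕ-filterB p φ xs) (trans (Σℕ-cong (by-cases φ) xs)
    (trans (Σℕ-+ _ _ xs) (trans (cong₂ _+_ (sym (Σℕ-filterB _ φ xs)) (sym (Σℕ-filterB _ φ xs)))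
                                (sym (Σℕ-++ φ (filterB _ xs) _)))))
    where
    by-cases : ∀ φ x → (if p x then φ x else 0) ≡ (if not (q x) ∧ p x then φ x else 0) + (if q x ∧ p x then φ x else 0)
    by-cases φ x with q x | p x
    ... | true  | true  = refl
    ... | true  | false = refl
    ... | false | true  = sym (+-identityʳ _)
    ... | false | false = refl

  filterB-∧-filterB : ∀ (p q : A → Bool) xs → filterB (λ d → p d ∧ q d) xs ≡ filterB q (filterB p xs)
  filterB-∧-filterB p q []       = refl
  filterB-∧-filterB p q (x ∷ xs) with p x
  ... | false = filterB-∧-filterB p q xs
  ... | true with q x
  ...   | true  = cong (x ∷_) (filterB-∧-filterB p q xs)
  ...   | false = filterB-∧-filterB p q xs

  -- Associativity of *

  *T-identityʳ : ∀ u → u *T leaf ≡ u ∷ []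
  *T-identityʳ leaf         = refl
  *T-identityʳ (node _ _ _) = refl

  *T-splitʳ : ∀ u a m l → u *T node a m l ≡ (u ≺T node a m l) ++ (u ·T node a m l) ++ (u ≻T node a m l)
  *T-splitʳ leaf         a m l = refl
  *T-splitʳ (node _ _ _) a m l = refl

  *T-splitˡ : ∀ a m l v → node a m l *T v ≡ (node a m l ≺T v) ++ (node a m l ·T v) ++ (node a m l ≻T v)
  *T-splitˡ a m l leaf         rewrite *T-identityʳ l = refl
  *T-splitˡ a m l (node _ _ _) = refl

  ≋-concatMap-split₃ : ∀ (f g h : A → List B) xs →
    concatMap (λ u → f u ++ g u ++ h u) xs ≋ concatMap f xs ++ concatMap g xs ++ concatMap h xs
  ≋-concatMap-split₃ f g h xs =
    ≋-trans (≋-concatMap-split f (λ u → g u ++ h u) xs)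
            (≋-++⁺ ≋-refl (≋-concatMap-split g h xs))

  ≋-regroup : ∀ (b₁ b₂ b₃ b₄ b₅ b₆ b₇ : List A) →
    (b₁ ++ b₂ ++ b₃) ++ (b₄ ++ b₅ ++ b₆) ++ b₇ ≋ b₁ ++ (b₂ ++ b₅ ++ b₄) ++ (b₃ ++ b₆ ++ b₇)
  ≋-regroup {A = A} b₁ b₂ b₃ b₄ b₅ b₆ b₇ = mk≋ regroup
    where
    open import Data.Nat.Solver using (module +-*-Solver)
    open +-*-Solver using (solve; _:=_; _:+_)
    regroup : ∀ φ → Σℕ φ ((b₁ ++ b₂ ++ b₃) ++ (b₄ ++ b₅ ++ b₆) ++ b₇)
                  ≡ Σℕ φ (b₁ ++ (b₂ ++ b₅ ++ b₄) ++ (b₃ ++ b₆ ++ b₇))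
    regroup φ = begin
      s ((b₁ ++ b₂ ++ b₃) ++ (b₄ ++ b₅ ++ b₆) ++ b₇)
        ≡⟨ Σℕ-++ φ (b₁ ++ b₂ ++ b₃) _ ⟩
      s (b₁ ++ b₂ ++ b₃) + s ((b₄ ++ b₅ ++ b₆) ++ b₇)
        ≡⟨ cong₂ _+_ (s-++₃ b₁ b₂ b₃) (trans (Σℕ-++ φ (b₄ ++ b₅ ++ b₆) b₇) (cong (_+ s b₇) (s-++₃ b₄ b₅ b₆))) ⟩
      (s b₁ + (s b₂ + s b₃)) + ((s b₄ + (s b₅ + s b₆)) + s b₇)
        ≡⟨ solve 7 (λ s₁ s₂ s₃ s₄ s₅ s₆ s₇ → (s₁ :+ (s₂ :+ s₃)) :+ ((s₄ :+ (s₅ :+ s₆)) :+ s₇)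
                      := s₁ :+ ((s₂ :+ (s₅ :+ s₄)) :+ (s₃ :+ (s₆ :+ s₇))))
                 refl (s b₁) (s b₂) (s b₃) (s b₄) (s b₅) (s b₆) (s b₇) ⟩
      s b₁ + ((s b₂ + (s b₅ + s b₄)) + (s b₃ + (s b₆ + s b₇)))
        ≡⟨ cong (s b₁ +_) (cong₂ _+_ (s-++₃ b₂ b₅ b₄) (s-++₃ b₃ b₆ b₇)) ⟨
      s b₁ + (s (b₂ ++ b₅ ++ b₄) + s (b₃ ++ b₆ ++ b₇))
        ≡⟨ s-++₃ b₁ (b₂ ++ b₅ ++ b₄) (b₃ ++ b₆ ++ b₇) ⟨
      s (b₁ ++ (b₂ ++ b₅ ++ b₄) ++ (b₃ ++ b₆ ++ b₇)) ∎
      where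
      s : List A → ℕ
      s = Σℕ φ
      s-++₃ : ∀ x y z → s (x ++ y ++ z) ≡ s x + (s y + s z)
      s-++₃ x y z = trans (Σℕ-++ φ x _) (cong (s x +_) (Σℕ-++ φ y z))

  *T-Assoc : Tree → Tree → Tree → Set
  *T-Assoc x y z = concatMap (_*T z) (x *T y) ≋ concatMap (x *T_) (y *T z)

  -- Both sides of (x * y) * z = x * (y * z), for three nodes, unfold into the
  -- same seven families of trees B₁ … B₇, sorted by which of ≺, ·, ≻ acts.
  module *T-AssocNodes (a : Tree) (m : List Tree) (l : Tree)
                       (a′ : Tree) (m′ : List Tree) (l′ : Tree)
                       (a″ : Tree) (m″ : List Tree) (l″ : Tree) where

    x y z : Tree
    x = node a m l
    y = node a′ m′ l′
    z = node a″ m″ l″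

    B₁ B₂ B₃ B₄ B₅ B₆ B₇ : List Tree
    B₁ = map (node a m) (concatMap (l *T_) (y *T z))
    B₂ = concatMap (λ s → map (node a (m ++ s ∷ m′)) (l′ *T z)) (l *T a′)
    B₃ = concatMap (λ s → map (node s m′) (l′ *T z)) (x *T a′)
    B₄ = map (λ w → node a (m ++ w ∷ m″) l″) (concatMap (l *T_) (y *T a″))
    B₅ = concatMap (λ s → map (λ w → node a ((m ++ s ∷ m′) ++ w ∷ m″) l″) (l′ *T a″)) (l *T a′)
    B₆ = concatMap (λ s → map (λ w → node s (m′ ++ w ∷ m″) l″) (l′ *T a″)) (x *T a′)
    B₇ = map (λ w → node w m″ l″) (concatMap (x *T_) (y *T a″))

    left-expansion : *T-Assoc l y z → *T-Assoc l y a″ → *T-Assoc x y a″ →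
                     concatMap (_*T z) (x *T y) ≋ (B₁ ++ B₂ ++ B₃) ++ (B₄ ++ B₅ ++ B₆) ++ B₇
    left-expansion assoc-lyz assoc-lya″ assoc-xya″ =
      ≋-trans (≋-concatMap-cong (λ u → ≋-reflexive (*T-splitʳ u a″ m″ l″)) (x *T y))
      (≋-trans (≋-concatMap-split₃ (_≺T z) (_·T z) (_≻T z) (x *T y))
               (≋-++⁺ via-≺ (≋-++⁺ via-· via-≻)))
      where
      Xˡ Xᵐ Xʳ : List Tree
      Xˡ = map (node a m) (l *T y)
      Xᵐ = map (λ s → node a (m ++ s ∷ m′) l′) (l *T a′)
      Xʳ = map (λ s → node s m′ l′) (x *T a′)
      via-≺ : concatMap (_≺T z) (Xˡ ++ Xᵐ ++ Xʳ) ≋ B₁ ++ B₂ ++ B₃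
      via-≺ = ≋-trans (≋-concatMap-++ (_≺T z) Xˡ (Xᵐ ++ Xʳ)) (≋-++⁺
        (≋-trans (≋-concatMap-map (_≺T z) (node a m) (l *T y))
          (≋-trans (≋-sym (≋-map-concatMap (node a m) (_*T z) (l *T y))) (≋-map⁺ (node a m) assoc-lyz)))
        (≋-trans (≋-concatMap-++ (_≺T z) Xᵐ Xʳ) (≋-++⁺
          (≋-concatMap-map (_≺T z) (λ s → node a (m ++ s ∷ m′) l′) (l *T a′))
          (≋-concatMap-map (_≺T z) (λ s → node s m′ l′) (x *T a′)))))
      via-· : concatMap (_·T z) (Xˡ ++ Xᵐ ++ Xʳ) ≋ B₄ ++ B₅ ++ B₆
      via-· = ≋-trans (≋-concatMap-++ (_·T z) Xˡ (Xᵐ ++ Xʳ)) (≋-++⁺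
        (≋-trans (≋-concatMap-map (_·T z) (node a m) (l *T y))
          (≋-trans (≋-sym (≋-map-concatMap (λ w → node a (m ++ w ∷ m″) l″) (_*T a″) (l *T y)))
            (≋-map⁺ (λ w → node a (m ++ w ∷ m″) l″) assoc-lya″)))
        (≋-trans (≋-concatMap-++ (_·T z) Xᵐ Xʳ) (≋-++⁺
          (≋-concatMap-map (_·T z) (λ s → node a (m ++ s ∷ m′) l′) (l *T a′))
          (≋-concatMap-map (_·T z) (λ s → node s m′ l′) (x *T a′)))))
      via-≻ : concatMap (_≻T z) (x *T y) ≋ B₇
      via-≻ = ≋-trans (≋-sym (≋-map-concatMap (λ w → node w m″ l″) (_*T a″) (x *T y)))
                      (≋-map⁺ (λ w → node w m″ l″) assoc-xya″)

    right-expansion : concatMap (x *T_) (y *T z) ≋ B₁ ++ (B₂ ++ B₅ ++ B₄) ++ (B₃ ++ B₆ ++ B₇)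
    right-expansion =
      ≋-trans (≋-concatMap-cong (λ v → ≋-reflexive (*T-splitˡ a m l v)) (y *T z))
      (≋-trans (≋-concatMap-split₃ (x ≺T_) (x ·T_) (x ≻T_) (y *T z))
               (≋-++⁺ via-≺ (≋-++⁺ via-· via-≻)))
      where
      Yˡ Yᵐ Yʳ : List Tree
      Yˡ = map (node a′ m′) (l′ *T z)
      Yᵐ = map (λ w → node a′ (m′ ++ w ∷ m″) l″) (l′ *T a″)
      Yʳ = map (λ q → node q m″ l″) (y *T a″)
      via-≺ : concatMap (x ≺T_) (y *T z) ≋ B₁
      via-≺ = ≋-sym (≋-map-concatMap (node a m) (l *T_) (y *T z))
      reassoc : ∀ s w → node a (m ++ s ∷ (m′ ++ w ∷ m″)) l″ ≡ node a ((m ++ s ∷ m′) ++ w ∷ m″) l″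
      reassoc s w = cong (λ q → node a q l″) (sym (++-assoc m (s ∷ m′) (w ∷ m″)))
      via-· : concatMap (x ·T_) (Yˡ ++ Yᵐ ++ Yʳ) ≋ B₂ ++ B₅ ++ B₄
      via-· = ≋-trans (≋-concatMap-++ (x ·T_) Yˡ (Yᵐ ++ Yʳ)) (≋-++⁺
        (≋-trans (≋-concatMap-map (x ·T_) (node a′ m′) (l′ *T z))
          (≋-map-comm (λ w s → node a (m ++ s ∷ m′) w) (l′ *T z) (l *T a′)))
        (≋-trans (≋-concatMap-++ (x ·T_) Yᵐ Yʳ) (≋-++⁺
          (≋-trans (≋-concatMap-map (x ·T_) (λ w → node a′ (m′ ++ w ∷ m″) l″) (l′ *T a″))
            (≋-trans (≋-map-comm (λ w s → node a (m ++ s ∷ (m′ ++ w ∷ m″)) l″) (l′ *T a″) (l *T a′))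
              (≋-concatMap-cong (λ s → ≋-reflexive (map-cong (reassoc s) (l′ *T a″))) (l *T a′))))
          (≋-trans (≋-concatMap-map (x ·T_) (λ q → node q m″ l″) (y *T a″))
            (≋-sym (≋-map-concatMap (λ w → node a (m ++ w ∷ m″) l″) (l *T_) (y *T a″)))))))
      via-≻ : concatMap (x ≻T_) (Yˡ ++ Yᵐ ++ Yʳ) ≋ B₃ ++ B₆ ++ B₇
      via-≻ = ≋-trans (≋-concatMap-++ (x ≻T_) Yˡ (Yᵐ ++ Yʳ)) (≋-++⁺
        (≋-trans (≋-concatMap-map (x ≻T_) (node a′ m′) (l′ *T z))
          (≋-map-comm (λ w s → node s m′ w) (l′ *T z) (x *T a′)))
        (≋-trans (≋-concatMap-++ (x ≻T_) Yᵐ Yʳ) (≋-++⁺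
          (≋-trans (≋-concatMap-map (x ≻T_) (λ w → node a′ (m′ ++ w ∷ m″) l″) (l′ *T a″))
            (≋-map-comm (λ w s → node s (m′ ++ w ∷ m″) l″) (l′ *T a″) (x *T a′)))
          (≋-trans (≋-concatMap-map (x ≻T_) (λ q → node q m″ l″) (y *T a″))
            (≋-sym (≋-map-concatMap (λ w → node w m″ l″) (x *T_) (y *T a″)))))))

    assoc : *T-Assoc l y z → *T-Assoc l y a″ → *T-Assoc x y a″ → *T-Assoc x y z
    assoc h₁ h₂ h₃ = ≋-trans (left-expansion h₁ h₂ h₃)
      (≋-trans (≋-regroup B₁ B₂ B₃ B₄ B₅ B₆ B₇) (≋-sym right-expansion))

  *T-assoc : ∀ x y z → *T-Assoc x y z
  *T-assoc leaf y z = ≋-trans (≋-++-identityʳ (y *T z)) (≋-sym (≋-concatMap-pure (y *T z)))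
  *T-assoc x@(node _ _ _) leaf z = ≋-trans (≋-++-identityʳ (x *T z)) (≋-sym (≋-++-identityʳ (x *T z)))
  *T-assoc x@(node _ _ _) y@(node _ _ _) leaf =
    ≋-trans (≋-concatMap-cong (λ u → ≋-reflexive (*T-identityʳ u)) (x *T y))
    (≋-trans (≋-concatMap-pure (x *T y)) (≋-sym (≋-++-identityʳ (x *T y))))
  *T-assoc x@(node a m l) y@(node a′ m′ l′) z@(node a″ m″ l″) =
    *T-AssocNodes.assoc a m l a′ m′ l′ a″ m″ l″ (*T-assoc l y z) (*T-assoc l y a″) (*T-assoc x y a″)

  infixl 7 _⊛_
  _⊛_ : List Tree → List Tree → List Tree
  xs ⊛ ys = concatMap (λ u → concatMap (u *T_) ys) xs

  ⊛-congˡ : ∀ {L L′} M → L ≋ L′ → L ⊛ M ≋ L′ ⊛ M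
  ⊛-congˡ M p = ≋-concatMap⁺ (λ u → concatMap (u *T_) M) p

  ⊛-assoc : ∀ L M N → (L ⊛ M) ⊛ N ≋ L ⊛ (M ⊛ N)
  ⊛-assoc L M N =
    ≋-trans (≋-concatMap-concatMap (λ w → concatMap (w *T_) N) (λ u → concatMap (u *T_) M) L)
            (≋-concatMap-cong pointwise L)
    where
    pointwise : ∀ u → concatMap (λ w → concatMap (w *T_) N) (concatMap (u *T_) M)
                    ≋ concatMap (u *T_) (M ⊛ N)
    pointwise u =
      ≋-trans (≋-concatMap-concatMap (λ w → concatMap (w *T_) N) (u *T_) M)
      (≋-trans (≋-concatMap-cong (λ v → ≋-trans (≋-concatMap-comm _*T_ (u *T v) N)
                                                (≋-concatMap-cong (*T-assoc u v) N)) M)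
      (≋-sym (≋-trans (≋-concatMap-concatMap (u *T_) (λ v → concatMap (v *T_) N) M)
                      (≋-concatMap-cong (λ v → ≋-concatMap-concatMap (u *T_) (v *T_) N) M))))

  prodT-++ : ∀ xs ys → prodT (xs ++ ys) ≋ prodT xs ⊛ prodT ys
  prodT-++ []       ys = ≋-trans (≋-sym (≋-concatMap-pure (prodT ys))) (≋-sym (≋-++-identityʳ _))
  prodT-++ (g ∷ gs) ys =
    ≋-trans (≋-concatMap⁺ (g *T_) (prodT-++ gs ys))
    (≋-trans (≋-sym (≋-++-identityʳ (concatMap (g *T_) (prodT gs ⊛ prodT ys))))
    (≋-trans (≋-sym (⊛-assoc (g ∷ []) (prodT gs) (prodT ys)))
             (⊛-congˡ (prodT ys) (≋-++-identityʳ (concatMap (g *T_) (prodT gs))))))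

  -- Addresses and cuts of a node, child by child

  lookupL-++ : ∀ (pre cs : List Tree) j → lookupL (length pre + j) (pre ++ cs) ≡ lookupL j cs
  lookupL-++ []        cs j = refl
  lookupL-++ (x ∷ pre) cs j = lookupL-++ pre cs j

  lookupL-at : ∀ (pre : List Tree) c cs → lookupL (length pre) (pre ++ c ∷ cs) ≡ just c
  lookupL-at pre c cs = trans (cong (λ n → lookupL n (pre ++ c ∷ cs)) (sym (+-identityʳ (length pre))))
                              (lookupL-++ pre (c ∷ cs) 0)

  subtreeAt-child : ∀ i t c p → lookupL i (children t) ≡ just c → subtreeAt (i ∷ p) t ≡ subtreeAt p c
  subtreeAt-child i t c p e with lookupL i (children t)
  subtreeAt-child i t c p refl | .(just c) = refl

  length-∷ʳ : ∀ (pre : List Tree) c → length (pre ++ c ∷ []) ≡ suc (length pre)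
  length-∷ʳ pre c = trans (length-++ pre) (+-comm (length pre) 1)

  childwise : (Tree → List Addr) → ℕ → List Tree → List Addr
  childwise f k []       = []
  childwise f k (c ∷ cs) = map (k ∷_) (f c) ++ childwise f (suc k) cs

  childwise-++ : ∀ (f : Tree → List Addr) k xs ys → childwise f k (xs ++ ys) ≡ childwise f k xs ++ childwise f (length xs + k) ys
  childwise-++ f k []       ys = refl
  childwise-++ f k (x ∷ xs) ys =
    trans (cong (map (k ∷_) (f x) ++_)
            (trans (childwise-++ f (suc k) xs ys) (cong (λ n → childwise f (suc k) xs ++ childwise f n ys) (+-suc (length xs) k))))
          (sym (++-assoc (map (k ∷_) (f x)) _ _))

  filterB-addrsL : ∀ t (Q : Addr → Bool) (R : Tree → Addr → Bool) →
    (∀ k c q → lookupL k (children t) ≡ just c → Q (k ∷ q) ≡ R c q) →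
    ∀ pre cs → children t ≡ pre ++ cs →
    filterB Q (addrsL (length pre) cs) ≡ childwise (λ c → filterB (R c) (addrs c)) (length pre) cs
  filterB-addrsL t Q R h pre []       e = refl
  filterB-addrsL t Q R h pre (c ∷ cs) e = begin
    filterB Q (map (length pre ∷_) (addrs c) ++ addrsL (suc (length pre)) cs)
      ≡⟨ filterB-++ Q (map (length pre ∷_) (addrs c)) _ ⟩
    filterB Q (map (length pre ∷_) (addrs c)) ++ filterB Q (addrsL (suc (length pre)) cs)
      ≡⟨ cong₂ _++_ first-child later-children ⟩
    map (length pre ∷_) (filterB (R c) (addrs c)) ++ childwise (λ c → filterB (R c) (addrs c)) (suc (length pre)) cs ∎
    where
    first-child : filterB Q (map (length pre ∷_) (addrs c)) ≡ map (length pre ∷_) (filterB (R c) (addrs c))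
    first-child = trans (filterB-map Q (length pre ∷_) (addrs c))
      (cong (map (length pre ∷_))
        (filterB-cong (λ q → h (length pre) c q (trans (cong (lookupL (length pre)) e) (lookupL-at pre c cs))) (addrs c)))
    later-children : filterB Q (addrsL (suc (length pre)) cs) ≡ childwise (λ c → filterB (R c) (addrs c)) (suc (length pre)) cs
    later-children = subst (λ n → filterB Q (addrsL n cs) ≡ childwise (λ c → filterB (R c) (addrs c)) n cs) (length-∷ʳ pre c)
      (filterB-addrsL t Q R h (pre ++ c ∷ []) cs (trans e (sym (++-assoc pre (c ∷ []) cs))))

  addrsL-++ : ∀ k (xs ys : List Tree) → addrsL k (xs ++ ys) ≡ addrsL k xs ++ addrsL (length xs + k) ys
  addrsL-++ k []       ys = refl
  addrsL-++ k (x ∷ xs) ys =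
    trans (cong (map (k ∷_) (addrs x) ++_)
            (trans (addrsL-++ (suc k) xs ys) (cong (λ n → addrsL (suc k) xs ++ addrsL n ys) (+-suc (length xs) k))))
          (sym (++-assoc (map (k ∷_) (addrs x)) _ _))

  addrs-node : ∀ a m l → addrs (node a m l) ≡ [] ∷ addrsL 0 (children (node a m l))
  addrs-node a m l = cong (λ as → [] ∷ map (0 ∷_) (addrs a) ++ as) (sym (begin
    addrsL 1 (m ++ l ∷ [])
      ≡⟨ addrsL-++ 1 m (l ∷ []) ⟩
    addrsL 1 m ++ addrsL (length m + 1) (l ∷ [])
      ≡⟨ cong (λ n → addrsL 1 m ++ addrsL n (l ∷ [])) (+-comm (length m) 1) ⟩
    addrsL 1 m ++ (map (suc (length m) ∷_) (addrs l) ++ [])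
      ≡⟨ cong (addrsL 1 m ++_) (++-identityʳ _) ⟩
    addrsL 1 m ++ map (suc (length m) ∷_) (addrs l) ∎))

  -- An internal vertex names the edge below it, so these are the internal edges
  -- of c together with the edge below c (the address []).
  innerVertices : Tree → List Addr
  innerVertices c = filterB (λ p → isNodeM (subtreeAt p c)) (addrs c)

  module _ (a : Tree) (m : List Tree) (l : Tree) where
    private
      t : Tree
      t = node a m l

      childwise-filter : (P : Maybe Tree → Bool) →
        filterB (λ p → P (subtreeAt p t)) (addrsL 0 (children t))
          ≡ childwise (λ c → filterB (λ q → P (subtreeAt q c)) (addrs c)) 0 (children t)
      childwise-filter P = filterB-addrsL t _ (λ c q → P (subtreeAt q c))
        (λ k c q e → cong P (subtreeAt-child k t c q e)) [] (children t) refl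

    internalEdges-node : internalEdges t ≡ childwise innerVertices 0 (children t)
    internalEdges-node =
      trans (cong (filterB (λ p → not (null p) ∧ isNodeM (subtreeAt p t))) (addrs-node a m l))
        (filterB-addrsL t _ (λ c q → isNodeM (subtreeAt q c))
          (λ k c q e → cong isNodeM (subtreeAt-child k t c q e)) [] (children t) refl)

    innerVertices-node : innerVertices t ≡ [] ∷ childwise innerVertices 0 (children t)
    innerVertices-node =
      trans (cong (filterB (λ p → isNodeM (subtreeAt p t))) (addrs-node a m l)) (cong ([] ∷_) (childwise-filter isNodeM))

    leafAddrs-node : leafAddrs t ≡ childwise leafAddrs 0 (children t)
    leafAddrs-node =
      trans (cong (filterB (λ p → isLeafM (subtreeAt p t))) (addrs-node a m l)) (childwise-filter isLeafM)

  sublists-++ : ∀ (xs ys : List A) → sublists (xs ++ ys) ≋ concatMap (λ u → map (u ++_) (sublists ys)) (sublists xs)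
  sublists-++ []       ys = ≋-sym (≋-trans (≋-++-identityʳ (map ([] ++_) (sublists ys))) (≋-reflexive (map-id (sublists ys))))
  sublists-++ (x ∷ xs) ys =
    ≋-trans (≋-++⁺ (≋-trans (≋-map⁺ (x ∷_) (sublists-++ xs ys))
                   (≋-trans (≋-map-concatMap (x ∷_) (λ u → map (u ++_) (sublists ys)) (sublists xs))
                            (≋-concatMap-cong (λ u → ≋-reflexive (sym (map-∘ (sublists ys)))) (sublists xs))))
                   (sublists-++ xs ys))
    (≋-sym (≋-trans (≋-concatMap-++ (λ u → map (u ++_) (sublists ys)) (map (x ∷_) (sublists xs)) (sublists xs))
                    (≋-++⁺ (≋-concatMap-map (λ u → map (u ++_) (sublists ys)) (x ∷_) (sublists xs)) ≋-refl)))

  sublists-map : ∀ (f : A → B) xs → sublists (map f xs) ≡ map (map f) (sublists xs)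
  sublists-map f []       = refl
  sublists-map f (x ∷ xs) = begin
    map (f x ∷_) (sublists (map f xs)) ++ sublists (map f xs)
      ≡⟨ cong (λ z → map (f x ∷_) z ++ z) (sublists-map f xs) ⟩
    map (f x ∷_) (map (map f) (sublists xs)) ++ map (map f) (sublists xs)
      ≡⟨ cong (_++ map (map f) (sublists xs)) (trans (sym (map-∘ (sublists xs))) (map-∘ (sublists xs))) ⟩
    map (map f) (map (x ∷_) (sublists xs)) ++ map (map f) (sublists xs)
      ≡⟨ map-++ (map f) (map (x ∷_) (sublists xs)) (sublists xs) ⟨
    map (map f) (map (x ∷_) (sublists xs) ++ sublists xs) ∎

  cutChoices : List Tree → List (List (List Addr))
  cutChoices []       = [] ∷ []
  cutChoices (c ∷ cs) = concatMap (λ d → map (d ∷_) (cutChoices cs)) (sublists (innerVertices c))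

  joinAt : ℕ → List (List Addr) → List Addr
  joinAt k []       = []
  joinAt k (d ∷ ds) = map (k ∷_) d ++ joinAt (suc k) ds

  sublists-childwise : ∀ k cs → sublists (childwise innerVertices k cs) ≋ map (joinAt k) (cutChoices cs)
  sublists-childwise k []       = ≋-refl
  sublists-childwise k (c ∷ cs) =
    ≋-trans (sublists-++ (map (k ∷_) (innerVertices c)) (childwise innerVertices (suc k) cs))
    (≋-trans (≋-reflexive (cong (concatMap (λ u → map (u ++_) rest)) (sublists-map (k ∷_) (innerVertices c))))
    (≋-trans (≋-concatMap-map (λ u → map (u ++_) rest) (map (k ∷_)) (sublists (innerVertices c)))
    (≋-trans (≋-concatMap-cong (λ d → ≋-trans (≋-map⁺ (map (k ∷_) d ++_) (sublists-childwise (suc k) cs))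
                                              (≋-reflexive (sym (map-∘ (cutChoices cs))))) (sublists (innerVertices c)))
    (≋-sym (≋-trans (≋-map-concatMap (joinAt k) (λ d → map (d ∷_) (cutChoices cs)) (sublists (innerVertices c)))
                    (≋-concatMap-cong (λ d → ≋-reflexive (sym (map-∘ (cutChoices cs)))) (sublists (innerVertices c))))))))
    where
    rest : List (List Addr)
    rest = sublists (childwise innerVertices (suc k) cs)

  cutChoices-length : ∀ cs → All (λ ds → length ds ≡ length cs) (cutChoices cs)
  cutChoices-length []       = refl ∷ []
  cutChoices-length (c ∷ cs) = go (sublists (innerVertices c))
    where
    go : ∀ L → All (λ ds → length ds ≡ length (c ∷ cs)) (concatMap (λ d → map (d ∷_) (cutChoices cs)) L)
    go []      = []
    go (d ∷ L) = Allₚ.++⁺ (Allₚ.map⁺ (All.map (cong suc) (cutChoices-length cs))) (go L)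

  ≡ᵇ-refl : ∀ k → (k ≡ᵇ k) ≡ true
  ≡ᵇ-refl zero    = refl
  ≡ᵇ-refl (suc k) = ≡ᵇ-refl k

  ≢⇒≡ᵇ-false : ∀ {m n} → m ≢ n → (m ≡ᵇ n) ≡ false
  ≢⇒≡ᵇ-false {m} {n} m≢n with m ≡ᵇ n in eq
  ... | false = refl
  ... | true  = ⊥-elim (m≢n (ℕₚ.≡ᵇ⇒≡ m n (subst T (sym eq) tt)))

  countOnPath-++ : ∀ xs ys q → countOnPath (xs ++ ys) q ≡ countOnPath xs q + countOnPath ys q
  countOnPath-++ xs ys q = trans (cong length (filterB-++ (λ p → isPrefix p q) xs ys))
                                 (length-++ (filterB (λ p → isPrefix p q) xs))

  countOnPath-map : ∀ k d k′ q → countOnPath (map (k ∷_) d) (k′ ∷ q) ≡ (if k ≡ᵇ k′ then countOnPath d q else 0)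
  countOnPath-map k d k′ q =
    trans (cong length (filterB-map (λ p → isPrefix p (k′ ∷ q)) (k ∷_) d))
    (trans (length-map (k ∷_) (filterB (λ p → (k ≡ᵇ k′) ∧ isPrefix p q) d)) (by-case (k ≡ᵇ k′)))
    where
    by-case : ∀ b → length (filterB (λ p → b ∧ isPrefix p q) d) ≡ (if b then countOnPath d q else 0)
    by-case true  = refl
    by-case false = cong length (filterB-false d)
      where
      filterB-false : ∀ (xs : List Addr) → filterB (λ _ → false) xs ≡ []
      filterB-false []       = refl
      filterB-false (_ ∷ xs) = filterB-false xs

  countOnPath-map-≢ : ∀ {k k′} d q → k ≢ k′ → countOnPath (map (k ∷_) d) (k′ ∷ q) ≡ 0
  countOnPath-map-≢ {k} {k′} d q k≢k′ =
    trans (countOnPath-map k d k′ q) (cong (λ b → if b then countOnPath d q else 0) (≢⇒≡ᵇ-false k≢k′))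

  countOnPath-joinAt-< : ∀ k ds k′ q → k′ < k → countOnPath (joinAt k ds) (k′ ∷ q) ≡ 0
  countOnPath-joinAt-< k []       k′ q k′<k = refl
  countOnPath-joinAt-< k (d ∷ ds) k′ q k′<k =
    trans (countOnPath-++ (map (k ∷_) d) (joinAt (suc k) ds) (k′ ∷ q))
      (cong₂ _+_ (countOnPath-map-≢ d q (ℕₚ.>⇒≢ k′<k))
                 (countOnPath-joinAt-< (suc k) ds k′ q (ℕₚ.m≤n⇒m≤1+n k′<k)))

  countOnPath-joinAt-head : ∀ k d ds q → countOnPath (joinAt k (d ∷ ds)) (k ∷ q) ≡ countOnPath d q
  countOnPath-joinAt-head k d ds q =
    trans (countOnPath-++ (map (k ∷_) d) (joinAt (suc k) ds) (k ∷ q))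
    (trans (cong₂ _+_ (trans (countOnPath-map k d k q) (cong (λ b → if b then countOnPath d q else 0) (≡ᵇ-refl k)))
                      (countOnPath-joinAt-< (suc k) ds k q ℕₚ.≤-refl))
           (+-identityʳ _))

  countOnPath-joinAt-tail : ∀ k d ds k′ q → k < k′ →
    countOnPath (joinAt k (d ∷ ds)) (k′ ∷ q) ≡ countOnPath (joinAt (suc k) ds) (k′ ∷ q)
  countOnPath-joinAt-tail k d ds k′ q k<k′ =
    trans (countOnPath-++ (map (k ∷_) d) (joinAt (suc k) ds) (k′ ∷ q))
          (cong (_+ countOnPath (joinAt (suc k) ds) (k′ ∷ q)) (countOnPath-map-≢ d q (ℕₚ.<⇒≢ k<k′)))

  -- A missing entry of a too short tuple is read as the empty cut.
  allAdmissible : List Tree → List (List Addr) → Bool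
  allAdmissible []       ds       = true
  allAdmissible (c ∷ cs) []       = admissibleB c [] ∧ allAdmissible cs []
  allAdmissible (c ∷ cs) (d ∷ ds) = admissibleB c d ∧ allAdmissible cs ds

  -- A path to a leaf of child k meets only the cut edges chosen in child k.
  admissible-joinAt : ∀ X k cs ds →
    (∀ k′ q → k ≤ k′ → countOnPath X (k′ ∷ q) ≡ countOnPath (joinAt k ds) (k′ ∷ q)) →
    allB (λ q → countOnPath X q ≤ᵇ 1) (childwise leafAddrs k cs) ≡ allAdmissible cs ds
  admissible-joinAt X k []       ds       h = refl
  admissible-joinAt X k (c ∷ cs) []       h =
    trans (allB-++ _ (map (k ∷_) (leafAddrs c)) _)
    (cong₂ _∧_ (trans (allB-map _ (k ∷_) (leafAddrs c))
                      (allB-cong (λ q → cong (_≤ᵇ 1) (h k q ℕₚ.≤-refl)) (leafAddrs c)))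
               (admissible-joinAt X (suc k) cs [] (λ k′ q k<k′ → h k′ q (ℕₚ.<⇒≤ k<k′))))
  admissible-joinAt X k (c ∷ cs) (d ∷ ds) h =
    trans (allB-++ _ (map (k ∷_) (leafAddrs c)) _)
    (cong₂ _∧_ (trans (allB-map _ (k ∷_) (leafAddrs c))
                      (allB-cong (λ q → cong (_≤ᵇ 1) (trans (h k q ℕₚ.≤-refl) (countOnPath-joinAt-head k d ds q))) (leafAddrs c)))
               (admissible-joinAt X (suc k) cs ds
                 (λ k′ q k<k′ → trans (h k′ q (ℕₚ.<⇒≤ k<k′)) (countOnPath-joinAt-tail k d ds k′ q k<k′))))

  admissible-node : ∀ a m l ds → admissibleB (node a m l) (joinAt 0 ds) ≡ allAdmissible (children (node a m l)) ds
  admissible-node a m l ds =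
    trans (cong (allB (λ q → countOnPath (joinAt 0 ds) q ≤ᵇ 1)) (leafAddrs-node a m l))
          (admissible-joinAt (joinAt 0 ds) 0 (children (node a m l)) ds (λ _ _ _ → refl))

  concatGs : List Tree → List (List Addr) → List Tree
  concatGs (c ∷ cs) (d ∷ ds) = Gs d c ++ concatGs cs ds
  concatGs _        _        = []

  mapPc : List Tree → List (List Addr) → List Tree
  mapPc (c ∷ cs) (d ∷ ds) = Pc d c ∷ mapPc cs ds
  mapPc _        _        = []

  Gs-child : ∀ t c k d → lookupL k (children t) ≡ just c → Gs (map (k ∷_) d) t ≡ Gs d c
  Gs-child t c k d e =
    trans (sym (map-∘ d)) (map-cong (λ p → cong (fromMaybe leaf) (subtreeAt-child k t c p e)) d)

  Gs-joinAt : ∀ t pre cs ds → children t ≡ pre ++ cs → length ds ≡ length cs →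
              Gs (joinAt (length pre) ds) t ≡ concatGs cs ds
  Gs-joinAt t pre []       []       e len = refl
  Gs-joinAt t pre (c ∷ cs) (d ∷ ds) e len =
    trans (map-++ _ (map (length pre ∷_) d) (joinAt (suc (length pre)) ds))
    (cong₂ _++_ (Gs-child t c (length pre) d (trans (cong (lookupL (length pre)) e) (lookupL-at pre c cs)))
      (subst (λ n → Gs (joinAt n ds) t ≡ concatGs cs ds) (length-∷ʳ pre c)
        (Gs-joinAt t (pre ++ c ∷ []) cs ds (trans e (sym (++-assoc pre (c ∷ []) cs))) (ℕₚ.suc-injective len))))

  data IsNode : Tree → Set where
    isNode : ∀ a m l → IsNode (node a m l)

  modL-∷ʳ : ∀ (f : Tree → Tree) j m l → modL f j (m ++ l ∷ []) ≡ modL f j m ++ (if j ≡ᵇ length m then f l else l) ∷ []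
  modL-∷ʳ f zero    []      l = refl
  modL-∷ʳ f (suc j) []      l = refl
  modL-∷ʳ f zero    (x ∷ m) l = refl
  modL-∷ʳ f (suc j) (x ∷ m) l = cong (x ∷_) (modL-∷ʳ f j m l)

  modL-at : ∀ (f : Tree → Tree) pre x post → modL f (length pre) (pre ++ x ∷ post) ≡ pre ++ f x ∷ post
  modL-at f []        x post = refl
  modL-at f (y ∷ pre) x post = cong (y ∷_) (modL-at f pre x post)

  children-prune : ∀ k p a m l → children (prune (k ∷ p) (node a m l)) ≡ modL (prune p) k (children (node a m l))
  children-prune zero    p a m l = refl
  children-prune (suc j) p a m l = cong (a ∷_) (sym (modL-∷ʳ (prune p) j m l))

  prune-isNode : ∀ k p a m l → IsNode (prune (k ∷ p) (node a m l))
  prune-isNode zero    p a m l = isNode _ _ _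
  prune-isNode (suc j) p a m l = isNode _ _ _

  Pc-child : ∀ d t pre x post → IsNode t → children t ≡ pre ++ x ∷ post →
    IsNode (Pc (map (length pre ∷_) d) t) × children (Pc (map (length pre ∷_) d) t) ≡ pre ++ Pc d x ∷ post
  Pc-child []      t pre x post n e = n , e
  Pc-child (p ∷ d) t pre x post n e with Pc (map (length pre ∷_) d) t | Pc-child d t pre x post n e
  ... | .(node a m l) | isNode a m l , e′ =
    prune-isNode (length pre) p a m l ,
    trans (children-prune (length pre) p a m l)
          (trans (cong (modL (prune p) (length pre)) e′) (modL-at (prune p) pre (Pc d x) post))

  Pc-joinAt : ∀ t pre cs ds → IsNode t → children t ≡ pre ++ cs → length ds ≡ length cs →
    IsNode (Pc (joinAt (length pre) ds) t) × children (Pc (joinAt (length pre) ds) t) ≡ pre ++ mapPc cs ds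
  Pc-joinAt t pre []       []       n e len = n , e
  Pc-joinAt t pre (c ∷ cs) (d ∷ ds) n e len
    with Pc-joinAt t (pre ++ c ∷ []) cs ds n (trans e (sym (++-assoc pre (c ∷ []) cs))) (ℕₚ.suc-injective len)
  ... | n′ , e′ rewrite foldr-++ prune t (map (length pre ∷_) d) (joinAt (suc (length pre)) ds) =
    Pc-child d _ pre c (mapPc cs ds) (subst (λ k → IsNode (Pc (joinAt k ds) t)) (length-∷ʳ pre c) n′)
      (trans (cong (λ k → children (Pc (joinAt k ds) t)) (sym (length-∷ʳ pre c)))
             (trans e′ (++-assoc pre (c ∷ []) (mapPc cs ds))))

  initLast : Tree → List Tree → List Tree × Tree
  initLast y []       = [] , y
  initLast y (z ∷ zs) = (y ∷ proj₁ (initLast z zs)) , proj₂ (initLast z zs)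

  fromChildren : List Tree → Tree
  fromChildren (x ∷ y ∷ ys) = node x (proj₁ (initLast y ys)) (proj₂ (initLast y ys))
  fromChildren _            = leaf

  initLast-∷ʳ : ∀ y m l → initLast y (m ++ l ∷ []) ≡ (y ∷ m , l)
  initLast-∷ʳ y []      l = refl
  initLast-∷ʳ y (z ∷ m) l rewrite initLast-∷ʳ z m l = refl

  fromChildren-children : ∀ a m l → fromChildren (children (node a m l)) ≡ node a m l
  fromChildren-children a []      l = refl
  fromChildren-children a (y ∷ m) l rewrite initLast-∷ʳ y m l = refl

  IsNode⇒fromChildren : ∀ {t} → IsNode t → t ≡ fromChildren (children t)
  IsNode⇒fromChildren (isNode a m l) = sym (fromChildren-children a m l)

  Pieces : Set
  Pieces = List Tree × Tree

  pieces : Tree → List Addr → Pieces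
  pieces t c = Gs c t , Pc c t

  -- All admissible cuts of t by internal edges: the empty cut but not the total one.
  edgeCutPieces : Tree → List Pieces
  edgeCutPieces t = map (pieces t) (filterB (admissibleB t) (sublists (internalEdges t)))

  -- Cuts of c as a child inside a larger tree: the edge below c may be cut too.
  childPieces : Tree → List Pieces
  childPieces c = map (pieces c) (filterB (admissibleB c) (sublists (innerVertices c)))

  ForestPieces : Set
  ForestPieces = List Tree × List Tree

  consPieces : Pieces → ForestPieces → ForestPieces
  consPieces (G , P) (Gs , Ps) = G ++ Gs , P ∷ Ps

  appendPieces : ForestPieces → ForestPieces → ForestPieces
  appendPieces (Gs , Ps) (Gs′ , Ps′) = Gs ++ Gs′ , Ps ++ Ps′

  forestPieces : List Tree → List ForestPieces
  forestPieces []       = ([] , []) ∷ []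
  forestPieces (c ∷ cs) = concatMap (λ A → map (consPieces A) (forestPieces cs)) (childPieces c)

  forestPieces-cutChoices : ∀ cs →
    map (λ ds → concatGs cs ds , mapPc cs ds) (filterB (allAdmissible cs) (cutChoices cs)) ≋ forestPieces cs
  forestPieces-cutChoices []       = ≋-refl
  forestPieces-cutChoices (c ∷ cs) =
    ≋-trans (≋-reflexive (cong (map pcs) (filterB-concatMap (allAdmissible (c ∷ cs)) (λ d → map (d ∷_) (cutChoices cs)) S)))
    (≋-trans (≋-map-concatMap pcs (λ d → filterB (allAdmissible (c ∷ cs)) (map (d ∷_) (cutChoices cs))) S)
    (≋-trans (≋-concatMap-cong per-cut S)
    (≋-sym (≋-trans (≋-concatMap-map (λ A → map (consPieces A) (forestPieces cs)) (pieces c) (filterB (admissibleB c) S))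
                    (≋-reflexive (concatMap-filterB (admissibleB c) _ S))))))
    where
    S : List (List Addr)
    S = sublists (innerVertices c)
    pcs : List (List Addr) → ForestPieces
    pcs ds = concatGs (c ∷ cs) ds , mapPc (c ∷ cs) ds
    admissibleRest : List (List (List Addr))
    admissibleRest = filterB (allAdmissible cs) (cutChoices cs)
    per-cut : ∀ d → map pcs (filterB (allAdmissible (c ∷ cs)) (map (d ∷_) (cutChoices cs)))
                  ≋ (if admissibleB c d then map (consPieces (pieces c d)) (forestPieces cs) else [])
    per-cut d = ≋-trans
      (≋-reflexive (begin
        map pcs (filterB (allAdmissible (c ∷ cs)) (map (d ∷_) (cutChoices cs)))
          ≡⟨ cong (map pcs) (filterB-map (allAdmissible (c ∷ cs)) (d ∷_) (cutChoices cs)) ⟩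
        map pcs (map (d ∷_) (filterB (λ ds → admissibleB c d ∧ allAdmissible cs ds) (cutChoices cs)))
          ≡⟨ cong (λ L → map pcs (map (d ∷_) L)) (filterB-∧ (admissibleB c d) (allAdmissible cs) (cutChoices cs)) ⟩
        map pcs (map (d ∷_) (if admissibleB c d then admissibleRest else []))
          ≡⟨ map-∘ (if admissibleB c d then admissibleRest else []) ⟨
        map (λ ds → pcs (d ∷ ds)) (if admissibleB c d then admissibleRest else [])
          ≡⟨ map-if (admissibleB c d) _ admissibleRest ⟩
        (if admissibleB c d then map (λ ds → pcs (d ∷ ds)) admissibleRest else []) ∎))
      (≋-if (admissibleB c d) (≋-trans (≋-reflexive (map-∘ admissibleRest))
                                       (≋-map⁺ (consPieces (pieces c d)) (forestPieces-cutChoices cs))))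

  assemble : ForestPieces → Pieces
  assemble (Gs , Ps) = Gs , fromChildren Ps

  edgeCutPieces-node : ∀ a m l → edgeCutPieces (node a m l) ≋ map assemble (forestPieces (children (node a m l)))
  edgeCutPieces-node a m l =
    ≋-trans (≋-reflexive (cong (λ E → map (pieces t) (filterB (admissibleB t) (sublists E))) (internalEdges-node a m l)))
    (≋-trans (≋-map⁺ (pieces t) (≋-filterB⁺ (admissibleB t) (sublists-childwise 0 cs)))
    (≋-trans (≋-reflexive (begin
       map (pieces t) (filterB (admissibleB t) (map (joinAt 0) (cutChoices cs)))
         ≡⟨ cong (map (pieces t)) (filterB-map (admissibleB t) (joinAt 0) (cutChoices cs)) ⟩
       map (pieces t) (map (joinAt 0) (filterB (λ ds → admissibleB t (joinAt 0 ds)) (cutChoices cs)))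
         ≡⟨ cong (λ L → map (pieces t) (map (joinAt 0) L)) (filterB-cong (admissible-node a m l) (cutChoices cs)) ⟩
       map (pieces t) (map (joinAt 0) (filterB (allAdmissible cs) (cutChoices cs)))
         ≡⟨ map-∘ (filterB (allAdmissible cs) (cutChoices cs)) ⟨
       map (λ ds → pieces t (joinAt 0 ds)) (filterB (allAdmissible cs) (cutChoices cs))
         ≡⟨ map-cong-local (All.map pieces-joinAt (filterB-All (allAdmissible cs) (cutChoices-length cs))) ⟩
       map (λ ds → assemble (concatGs cs ds , mapPc cs ds)) (filterB (allAdmissible cs) (cutChoices cs))
         ≡⟨ map-∘ (filterB (allAdmissible cs) (cutChoices cs)) ⟩
       map assemble (map (λ ds → concatGs cs ds , mapPc cs ds) (filterB (allAdmissible cs) (cutChoices cs))) ∎))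
    (≋-map⁺ assemble (forestPieces-cutChoices cs))))
    where
    t : Tree
    t = node a m l
    cs : List Tree
    cs = children t
    pieces-joinAt : ∀ {ds} → length ds ≡ length cs → pieces t (joinAt 0 ds) ≡ assemble (concatGs cs ds , mapPc cs ds)
    pieces-joinAt {ds} len with Pc-joinAt t [] cs ds (isNode a m l) refl len
    ... | n , e = cong₂ _,_ (Gs-joinAt t [] cs ds refl len) (trans (IsNode⇒fromChildren n) (cong fromChildren e))

  forestPieces-++ : ∀ xs ys → forestPieces (xs ++ ys) ≋ concatMap (λ X → map (appendPieces X) (forestPieces ys)) (forestPieces xs)
  forestPieces-++ []       ys = ≋-sym (≋-trans (≋-++-identityʳ (map (appendPieces ([] , [])) (forestPieces ys)))
                                               (≋-reflexive (map-id (forestPieces ys))))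
  forestPieces-++ (x ∷ xs) ys =
    ≋-trans (≋-concatMap-cong (λ A → ≋-map⁺ (consPieces A) (forestPieces-++ xs ys)) (childPieces x))
    (≋-trans (≋-concatMap-cong (λ A →
                ≋-trans (≋-map-concatMap (consPieces A) (λ X → map (appendPieces X) (forestPieces ys)) (forestPieces xs))
                        (≋-concatMap-cong (λ X → ≋-reflexive (trans (sym (map-∘ (forestPieces ys)))
                                                    (map-cong (cons-append A X) (forestPieces ys)))) (forestPieces xs)))
              (childPieces x))
    (≋-sym (≋-trans (≋-concatMap-concatMap (λ X → map (appendPieces X) (forestPieces ys)) (λ A → map (consPieces A) (forestPieces xs)) (childPieces x))
                    (≋-concatMap-cong (λ A → ≋-concatMap-map (λ X → map (appendPieces X) (forestPieces ys)) (consPieces A) (forestPieces xs))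
                                      (childPieces x)))))
    where
    cons-append : ∀ A X Y → consPieces A (appendPieces X Y) ≡ appendPieces (consPieces A X) Y
    cons-append (G , P) (Gs , Ps) (Gs′ , Ps′) = cong (_, P ∷ Ps ++ Ps′) (sym (++-assoc G Gs Gs′))

  nodePiece : Pieces → ForestPieces → Pieces → Pieces
  nodePiece (Ga , Pa) (Gm , Pm) (Gl , Pl) = Ga ++ Gm ++ Gl , node Pa Pm Pl

  nodePieces : Tree → List Tree → Tree → List Pieces
  nodePieces a m l = concatMap (λ A → concatMap (λ M → map (nodePiece A M) (childPieces l)) (forestPieces m)) (childPieces a)

  edgeCutPieces≋nodePieces : ∀ a m l → edgeCutPieces (node a m l) ≋ nodePieces a m l
  edgeCutPieces≋nodePieces a m l =
    ≋-trans (edgeCutPieces-node a m l)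
    (≋-trans (≋-map-concatMap assemble (λ A → map (consPieces A) (forestPieces (m ++ l ∷ []))) (childPieces a))
    (≋-concatMap-cong (λ A →
       ≋-trans (≋-reflexive (sym (map-∘ (forestPieces (m ++ l ∷ [])))))
       (≋-trans (≋-map⁺ (λ R → assemble (consPieces A R)) (forestPieces-++ m (l ∷ [])))
       (≋-trans (≋-map-concatMap (λ R → assemble (consPieces A R)) (λ X → map (appendPieces X) (forestPieces (l ∷ []))) (forestPieces m))
       (≋-concatMap-cong (λ M →
          ≋-trans (≋-reflexive (sym (map-∘ (forestPieces (l ∷ [])))))
          (≋-trans (≋-map⁺ (λ Y → assemble (consPieces A (appendPieces M Y))) (≋-concatMap-singleton _ (childPieces l)))
          (≋-reflexive (trans (sym (map-∘ (childPieces l))) (map-cong (assemble-node A M) (childPieces l))))))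
         (forestPieces m))))) (childPieces a)))
    where
    assemble-node : ∀ A M L → assemble (consPieces A (appendPieces M (consPieces L ([] , [])))) ≡ nodePiece A M L
    assemble-node (Ga , Pa) (Gm , Pm) (Gl , Pl) =
      cong₂ _,_ (cong (λ z → Ga ++ Gm ++ z) (++-identityʳ Gl)) (fromChildren-children Pa Pm Pl)

  LeafAbove : Addr → List Addr → Set
  LeafAbove p = Any (λ q → isPrefix p q ≡ true)

  leafAbove-child : ∀ k {p L} → LeafAbove p L → LeafAbove (k ∷ p) (map (k ∷_) L)
  leafAbove-child k {p} h = Anyₚ.map⁺ (Any.map (λ {q} → trans (cong (_∧ isPrefix p q) (≡ᵇ-refl k))) h)

  All-addrs-root : ∀ {P : Addr → Set} c → All P (addrs c) → P []
  All-addrs-root leaf         (p ∷ _) = p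
  All-addrs-root (node _ _ _) (p ∷ _) = p

  mutual
    leavesAbove : ∀ c → All (λ p → LeafAbove p (leafAddrs c)) (addrs c)
    leavesAbove leaf         = here refl ∷ []
    leavesAbove (node a m l) =
      subst (λ L → All (λ p → LeafAbove p L) (addrs (node a m l))) (sym (leafAddrs-node a m l))
        (Anyₚ.++⁺ˡ (Anyₚ.map⁺ (Any.map (λ _ → refl) (All-addrs-root a (leavesAbove a))))
         ∷ Allₚ.++⁺ (All.map Anyₚ.++⁺ˡ (lift 0 (leavesAbove a)))
                    (All.map (Anyₚ.++⁺ʳ (map (0 ∷_) (leafAddrs a)))
                      (subst (λ L → All (λ p → LeafAbove p L) (addrsL 1 m ++ map (suc (length m) ∷_) (addrs l)))
                             (sym (trans (childwise-++ leafAddrs 1 m (l ∷ []))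
                                    (cong (λ n → childwise leafAddrs 1 m ++ map (n ∷_) (leafAddrs l) ++ []) (+-comm (length m) 1))))
                        (Allₚ.++⁺ (All.map Anyₚ.++⁺ˡ (leavesAboveᶠ 1 m))
                                  (All.map (Anyₚ.++⁺ʳ (childwise leafAddrs 1 m) ∘ Anyₚ.++⁺ˡ) (lift (suc (length m)) (leavesAbove l)))))))
      where
      lift : ∀ k {c} → All (λ p → LeafAbove p (leafAddrs c)) (addrs c) →
             All (λ p → LeafAbove p (map (k ∷_) (leafAddrs c))) (map (k ∷_) (addrs c))
      lift k h = Allₚ.map⁺ (All.map (leafAbove-child k) h)

    leavesAboveᶠ : ∀ k cs → All (λ p → LeafAbove p (childwise leafAddrs k cs)) (addrsL k cs)
    leavesAboveᶠ k []       = []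
    leavesAboveᶠ k (c ∷ cs) =
      Allₚ.++⁺ (All.map (Anyₚ.++⁺ˡ {ys = childwise leafAddrs (suc k) cs}) (Allₚ.map⁺ (All.map (leafAbove-child k) (leavesAbove c))))
               (All.map (Anyₚ.++⁺ʳ (map (k ∷_) (leafAddrs c))) (leavesAboveᶠ (suc k) cs))

  admissible-empty : ∀ c → admissibleB c [] ≡ true
  admissible-empty c = allB-true (leafAddrs c)

  -- A leaf above a second cut edge p would meet two edges of the cut.
  admissible-root : ∀ c d → All (_∈ addrs c) d → admissibleB c ([] ∷ d) ≡ null d
  admissible-root c []      _          = allB-true (leafAddrs c)
  admissible-root c (p ∷ d) (p∈ ∷ _) = allB-false _ (Any.map twoOnPath (All.lookup (leavesAbove c) p∈))
    where
    twoOnPath : ∀ {q} → isPrefix p q ≡ true → (countOnPath ([] ∷ p ∷ d) q ≤ᵇ 1) ≡ false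
    twoOnPath {q} e rewrite e = refl

  childPieces-node : ∀ a m l → childPieces (node a m l) ≡ (node a m l ∷ [] , leaf) ∷ edgeCutPieces (node a m l)
  childPieces-node a m l = begin
    map (pieces t) (filterB (admissibleB t) (sublists (innerVertices t)))
      ≡⟨ cong (λ E → map (pieces t) (filterB (admissibleB t) (sublists E)))
              (trans (innerVertices-node a m l) (cong ([] ∷_) (sym (internalEdges-node a m l)))) ⟩
    map (pieces t) (filterB (admissibleB t) (map ([] ∷_) S ++ S))
      ≡⟨ cong (map (pieces t)) (filterB-++ (admissibleB t) (map ([] ∷_) S) S) ⟩
    map (pieces t) (filterB (admissibleB t) (map ([] ∷_) S) ++ filterB (admissibleB t) S)
      ≡⟨ cong (λ z → map (pieces t) (z ++ filterB (admissibleB t) S)) onlyRoot ⟩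
    map (pieces t) (([] ∷ []) ∷ filterB (admissibleB t) S) ∎
    where
    t : Tree
    t = node a m l
    S : List (List Addr)
    S = sublists (internalEdges t)
    onlyRoot : filterB (admissibleB t) (map ([] ∷_) S) ≡ ([] ∷ []) ∷ []
    onlyRoot = trans (filterB-map (admissibleB t) ([] ∷_) S)
      (cong (map ([] ∷_)) (trans
        (filterB-cong-local (All.map (λ {d} d⊆ → admissible-root t d (All.map (filterB-⊆ (λ p → not (null p) ∧ isNodeM (subtreeAt p t)) (addrs t)) d⊆))
                                     (sublists-⊆ (internalEdges t))))
        (filterB-null-sublists (internalEdges t))))

  tensorTerms : List Pieces → List (Tree × Tree)
  tensorTerms = concatMap (λ A → map (_, proj₂ A) (prodT (proj₁ A)))

  cutTerms-edgeCuts : ∀ t → cutTerms t ≋ (t , leaf) ∷ tensorTerms (edgeCutPieces t)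
  cutTerms-edgeCuts t = ≋-trans (≋-swap (leaf , t) (t , leaf) _) (≋-++⁺ (≋-refl {xs = (t , leaf) ∷ []}) (≋-sym split))
    where
    S : List (List Addr)
    S = sublists (internalEdges t)
    emptyCut : filterB (λ d → null d ∧ admissibleB t d) S ≡ [] ∷ []
    emptyCut = trans (filterB-∧-filterB null (admissibleB t) S)
      (trans (cong (filterB (admissibleB t)) (filterB-null-sublists (internalEdges t)))
             (cong (λ b → if b then [] ∷ [] else []) (admissible-empty t)))
    split : tensorTerms (edgeCutPieces t) ≋ (leaf , t) ∷ concatMap (λ c → map (_, Pc c t) (prodT (Gs c t))) (properCuts t)
    split =
      ≋-trans (≋-concatMap⁺ _ (≋-map⁺ (pieces t) (filterB-split (admissibleB t) null S)))
      (≋-trans (≋-reflexive (cong (λ z → tensorTerms (map (pieces t) (properCuts t ++ z))) emptyCut))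
      (≋-trans (≋-reflexive (cong tensorTerms (map-++ (pieces t) (properCuts t) ([] ∷ []))))
      (≋-trans (≋-concatMap-++ _ (map (pieces t) (properCuts t)) (pieces t [] ∷ []))
      (≋-trans (≋-++-comm (tensorTerms (map (pieces t) (properCuts t))) ((leaf , t) ∷ []))
               (≋-++⁺ (≋-refl {xs = (leaf , t) ∷ []}) (≋-concatMap-map _ (pieces t) (properCuts t)))))))

  cutTerms-node : ∀ a m l → cutTerms (node a m l) ≋ (node a m l , leaf) ∷ tensorTerms (nodePieces a m l)
  cutTerms-node a m l = ≋-trans (cutTerms-edgeCuts (node a m l))
    (≋-++⁺ (≋-refl {xs = (node a m l , leaf) ∷ []}) (≋-concatMap⁺ _ (edgeCutPieces≋nodePieces a m l)))

  -- Products of cut sums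

  tensorOp : (Tree → Tree → List Tree) → List (Tree × Tree) → List (Tree × Tree) → List (Tree × Tree)
  tensorOp op X Y = concatMap (λ p → concatMap (tensOp op p) Y) X

  tensorOp-cong : ∀ op {X X′ Y Y′} → X ≋ X′ → Y ≋ Y′ → tensorOp op X Y ≋ tensorOp op X′ Y′
  tensorOp-cong op {X} {X′} {Y} {Y′} e f =
    ≋-trans (≋-concatMap⁺ (λ p → concatMap (tensOp op p) Y) e) (≋-concatMap-cong (λ p → ≋-concatMap⁺ (tensOp op p) f) X′)

  -- Concatenating the lists of cut-off trees multiplies their products.
  piecesOp : (Tree → Tree → List Tree) → Pieces → Pieces → List Pieces
  piecesOp op (G , P) (G′ , P′) = map (G ++ G′ ,_) (op P P′)

  productPieces : (Tree → Tree → List Tree) → List Pieces → List Pieces → List Pieces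
  productPieces op L L′ = concatMap (λ A → concatMap (piecesOp op A) L′) L

  tensOp-node : ∀ op g {P} q → IsNode P → tensOp op (g , P) q ≡ concatMap (λ s → map (s ,_) (op P (proj₂ q))) (g *T proj₁ q)
  tensOp-node op g q (isNode _ _ _) = refl

  -- When the left remaining part is not |, the special case of ⋉ on A ⊗̄ A never
  -- applies, so the product of cut sums is computed piece by piece.
  tensorOp-pieces : ∀ op G {P} G′ P′ → IsNode P →
    concatMap (λ g → concatMap (λ g′ → tensOp op (g , P) (g′ , P′)) (prodT G′)) (prodT G)
      ≋ tensorTerms (piecesOp op (G , P) (G′ , P′))
  tensorOp-pieces op G {P} G′ P′ nP =
    ≋-trans (≋-concatMap-cong (λ g → ≋-concatMap-cong (λ g′ → ≋-reflexive (tensOp-node op g (g′ , P′) nP)) (prodT G′)) (prodT G))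
    (≋-trans (≋-concatMap-cong (λ g → ≋-sym (≋-concatMap-concatMap (λ s → map (s ,_) Qs) (g *T_) (prodT G′))) (prodT G))
    (≋-trans (≋-sym (≋-concatMap-concatMap (λ s → map (s ,_) Qs) (λ g → concatMap (g *T_) (prodT G′)) (prodT G)))
    (≋-trans (≋-map-comm _,_ (prodT G ⊛ prodT G′) Qs)
    (≋-trans (≋-concatMap-cong (λ Q → ≋-map⁺ (_, Q) (≋-sym (prodT-++ G G′))) Qs)
             (≋-sym (≋-concatMap-map (λ A → map (_, proj₂ A) (prodT (proj₁ A))) (G ++ G′ ,_) Qs))))))
    where
    Qs : List Tree
    Qs = op P P′

  tensorOp-tensorTerms : ∀ op L L′ → All (IsNode ∘ proj₂) L →
    tensorOp op (tensorTerms L) (tensorTerms L′) ≋ tensorTerms (productPieces op L L′)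
  tensorOp-tensorTerms op L L′ nodes =
    ≋-trans (≋-concatMap-concatMap (λ p → concatMap (tensOp op p) TL′) (λ A → map (_, proj₂ A) (prodT (proj₁ A))) L)
    (≋-trans (≋-concatMap-cong-local per-piece nodes)
             (≋-sym (≋-concatMap-concatMap (λ A → map (_, proj₂ A) (prodT (proj₁ A))) (λ A → concatMap (piecesOp op A) L′) L)))
    where
    TL′ : List (Tree × Tree)
    TL′ = tensorTerms L′
    per-piece : ∀ {A} → IsNode (proj₂ A) →
      concatMap (λ p → concatMap (tensOp op p) TL′) (map (_, proj₂ A) (prodT (proj₁ A)))
        ≋ tensorTerms (concatMap (piecesOp op A) L′)
    per-piece {G , P} nP =
      ≋-trans (≋-concatMap-map (λ p → concatMap (tensOp op p) TL′) (_, P) (prodT G))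
      (≋-trans (≋-concatMap-cong (λ g → ≋-concatMap-concatMap (tensOp op (g , P)) (λ A → map (_, proj₂ A) (prodT (proj₁ A))) L′) (prodT G))
      (≋-trans (≋-concatMap-comm (λ g A′ → concatMap (tensOp op (g , P)) (map (_, proj₂ A′) (prodT (proj₁ A′)))) (prodT G) L′)
      (≋-trans (≋-concatMap-cong (λ A′ →
                  ≋-trans (≋-concatMap-cong (λ g → ≋-concatMap-map (tensOp op (g , P)) (_, proj₂ A′) (prodT (proj₁ A′))) (prodT G))
                          (tensorOp-pieces op G (proj₁ A′) (proj₂ A′) nP)) L′)
               (≋-sym (≋-concatMap-concatMap (λ A → map (_, proj₂ A) (prodT (proj₁ A))) (piecesOp op (G , P)) L′)))))

  rootPiece : Tree → Pieces
  rootPiece c = c ∷ [] , leaf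

  All-concatMap : {P : B → Set} (f : A → List B) → (∀ x → All P (f x)) → ∀ xs → All P (concatMap f xs)
  All-concatMap f h []       = []
  All-concatMap f h (x ∷ xs) = Allₚ.++⁺ (h x) (All-concatMap f h xs)

  nodePieces-isNode : ∀ a m l → All (IsNode ∘ proj₂) (nodePieces a m l)
  nodePieces-isNode a m l =
    All-concatMap _ (λ A → All-concatMap _ (λ M → Allₚ.map⁺ (All.tabulate (λ _ → isNode _ _ _))) (forestPieces m)) (childPieces a)

  concatMap-nodePieces : ∀ (f : Pieces → List B) a m l →
    concatMap f (nodePieces a m l)
      ≋ concatMap (λ A → concatMap (λ M → concatMap (λ L → f (nodePiece A M L)) (childPieces l)) (forestPieces m)) (childPieces a)
  concatMap-nodePieces f a m l =
    ≋-trans (≋-concatMap-concatMap f (λ A → concatMap (λ M → map (nodePiece A M) (childPieces l)) (forestPieces m)) (childPieces a))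
    (≋-concatMap-cong (λ A →
      ≋-trans (≋-concatMap-concatMap f (λ M → map (nodePiece A M) (childPieces l)) (forestPieces m))
              (≋-concatMap-cong (λ M → ≋-concatMap-map f (nodePiece A M) (childPieces l)) (forestPieces m))) (childPieces a))

  childPieces≋ : ∀ a m l → childPieces (node a m l) ≋ rootPiece (node a m l) ∷ nodePieces a m l
  childPieces≋ a m l = ≋-trans (≋-reflexive (childPieces-node a m l))
                               (≋-++⁺ (≋-refl {xs = rootPiece (node a m l) ∷ []}) (edgeCutPieces≋nodePieces a m l))

  tensOp-leaf-node : ∀ op x g {P} → IsNode P → tensOp op (x , leaf) (g , P) ≡ concatMap (λ s → map (s ,_) (op leaf P)) (x *T g)
  tensOp-leaf-node op x g (isNode _ _ _) = refl

  -- For ≺ and ·, the products with the total cut x ⊗ | vanish since | ≺ P = | · P = 0.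
  totalCutRow-vanishes : ∀ op x → (∀ P → IsNode P → op leaf P ≡ []) →
    ∀ L → All (IsNode ∘ proj₂) L → concatMap (tensOp op (x , leaf)) (tensorTerms L) ≋ []
  totalCutRow-vanishes op x leaf-op L nodes =
    ≋-trans (≋-concatMap-concatMap (tensOp op (x , leaf)) (λ A → map (_, proj₂ A) (prodT (proj₁ A))) L)
    (≋-trans (≋-concatMap-cong-local (λ {A} → per-piece {A}) nodes) (≋-concatMap-empty L))
    where
    per-piece : ∀ {A} → IsNode (proj₂ A) → concatMap (tensOp op (x , leaf)) (map (_, proj₂ A) (prodT (proj₁ A))) ≋ []
    per-piece {G , P} nP =
      ≋-trans (≋-concatMap-map (tensOp op (x , leaf)) (_, P) (prodT G))
      (≋-trans (≋-concatMap-cong (λ g → ≋-reflexive (trans (tensOp-leaf-node op x g nP)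
                                    (cong (λ Qs → concatMap (λ s → map (s ,_) Qs) (x *T g)) (leaf-op P nP)))) (prodT G))
               (≋-trans (≋-concatMap-cong (λ g → ≋-concatMap-empty (x *T g)) (prodT G)) (≋-concatMap-empty (prodT G))))

  tensorOp-cutTerms : ∀ op xa xm xl ya ym yl →
    tensorOp op (cutTerms (node xa xm xl)) (cutTerms (node ya ym yl))
      ≋ concatMap (tensOp op (node xa xm xl , leaf)) (tensorTerms (rootPiece (node ya ym yl) ∷ nodePieces ya ym yl))
        ++ tensorTerms (productPieces op (nodePieces xa xm xl) (rootPiece (node ya ym yl) ∷ nodePieces ya ym yl))
  tensorOp-cutTerms op xa xm xl ya ym yl =
    ≋-trans (tensorOp-cong op (cutTerms-node xa xm xl) (cutTerms-node ya ym yl))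
            (≋-++⁺ ≋-refl (tensorOp-tensorTerms op (nodePieces xa xm xl) (rootPiece (node ya ym yl) ∷ nodePieces ya ym yl)
                                                  (nodePieces-isNode xa xm xl)))

  module _ (a m₁ : Tree) (ms : List Tree) (l : Tree) where
    private
      x y t : Tree
      x = node a [] m₁
      y = node leaf ms l
      t = node a (m₁ ∷ ms) l

    dot-pieces : productPieces _·T_ (nodePieces a [] m₁) (rootPiece y ∷ nodePieces leaf ms l) ≋ nodePieces a (m₁ ∷ ms) l
    dot-pieces =
      ≋-trans (concatMap-nodePieces F a [] m₁)
      (≋-concatMap-cong (λ A → ≋-trans (≋-++-identityʳ _) (≋-trans (≋-concatMap-cong (per-child A) (childPieces m₁))
                                       (≋-sym (regroup A)))) (childPieces a))
      where
      F : Pieces → List Pieces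
      F X = concatMap (piecesOp _·T_ X) (rootPiece y ∷ nodePieces leaf ms l)
      merge : ∀ A L₁ M′ L′ → piecesOp _·T_ (nodePiece A ([] , []) L₁) (nodePiece ([] , leaf) M′ L′)
                            ≡ nodePiece A (consPieces L₁ M′) L′ ∷ []
      merge (Ga , Pa) (G₁ , P₁) (Gm , Pm) (Gl , Pl) rewrite *T-identityʳ P₁ =
        cong (λ G → (G , node Pa (P₁ ∷ Pm) Pl) ∷ []) (begin
          (Ga ++ G₁) ++ Gm ++ Gl   ≡⟨ ++-assoc Ga G₁ (Gm ++ Gl) ⟩
          Ga ++ G₁ ++ Gm ++ Gl     ≡⟨ cong (Ga ++_) (++-assoc G₁ Gm Gl) ⟨
          Ga ++ (G₁ ++ Gm) ++ Gl   ∎)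
      per-child : ∀ A L₁ → F (nodePiece A ([] , []) L₁)
                         ≋ concatMap (λ M′ → map (nodePiece A (consPieces L₁ M′)) (childPieces l)) (forestPieces ms)
      per-child A L₁ =
        ≋-trans (concatMap-nodePieces (piecesOp _·T_ (nodePiece A ([] , []) L₁)) leaf ms l)
        (≋-trans (≋-++-identityʳ _)
        (≋-concatMap-cong (λ M′ → ≋-trans (≋-concatMap-cong (λ L′ → ≋-reflexive (merge A L₁ M′ L′)) (childPieces l))
                                          (≋-concatMap-singleton (nodePiece A (consPieces L₁ M′)) (childPieces l)))
                          (forestPieces ms)))
      regroup : ∀ A → concatMap (λ M → map (nodePiece A M) (childPieces l)) (forestPieces (m₁ ∷ ms))
                    ≋ concatMap (λ L₁ → concatMap (λ M′ → map (nodePiece A (consPieces L₁ M′)) (childPieces l)) (forestPieces ms))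
                                (childPieces m₁)
      regroup A =
        ≋-trans (≋-concatMap-concatMap (λ M → map (nodePiece A M) (childPieces l)) (λ L₁ → map (consPieces L₁) (forestPieces ms)) (childPieces m₁))
                (≋-concatMap-cong (λ L₁ → ≋-concatMap-map (λ M → map (nodePiece A M) (childPieces l)) (consPieces L₁) (forestPieces ms))
                                  (childPieces m₁))

    dot-identity : tensorOp _·T_ (cutTerms x) (cutTerms y) ≋ cutTerms t
    dot-identity =
      ≋-trans (tensorOp-cutTerms _·T_ a [] m₁ leaf ms l)
      (≋-trans (≋-++⁺ totalCutRow (≋-concatMap⁺ _ dot-pieces))
               (≋-sym (cutTerms-node a (m₁ ∷ ms) l)))
      where
      totalCutRow : concatMap (tensOp _·T_ (x , leaf)) (tensorTerms (rootPiece y ∷ nodePieces leaf ms l)) ≋ (t , leaf) ∷ []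
      totalCutRow rewrite *T-identityʳ m₁ =
        ≋-++⁺ (≋-refl {xs = (t , leaf) ∷ []})
              (totalCutRow-vanishes _·T_ x (λ { _ (isNode _ _ _) → refl }) (nodePieces leaf ms l) (nodePieces-isNode leaf ms l))

  module _ (a l₁ : Tree) (l₂ : List Tree) (l₃ : Tree) where
    private
      x l t : Tree
      x = node a [] leaf
      l = node l₁ l₂ l₃
      t = node a [] l

    prec-pieces : productPieces _≺T_ (nodePieces a [] leaf) (rootPiece l ∷ nodePieces l₁ l₂ l₃) ≋ nodePieces a [] l
    prec-pieces =
      ≋-trans (concatMap-nodePieces F a [] leaf)
      (≋-concatMap-cong (λ A → ≋-trans (≋-++-identityʳ _) (≋-trans (≋-++-identityʳ _)
                                 (≋-trans (per-root A) (≋-sym (≋-++-identityʳ _)))))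
                        (childPieces a))
      where
      F : Pieces → List Pieces
      F X = concatMap (piecesOp _≺T_ X) (rootPiece l ∷ nodePieces l₁ l₂ l₃)
      per-root : ∀ A → F (nodePiece A ([] , []) ([] , leaf)) ≋ map (nodePiece A ([] , [])) (childPieces l)
      per-root (Ga , Pa) =
        ≋-trans (≋-concatMap-singleton _ (rootPiece l ∷ nodePieces l₁ l₂ l₃))
        (≋-trans (≋-reflexive (map-cong (λ B → cong (λ G → G ++ proj₁ B , node Pa [] (proj₂ B)) (++-identityʳ Ga))
                                        (rootPiece l ∷ nodePieces l₁ l₂ l₃)))
                 (≋-map⁺ (nodePiece (Ga , Pa) ([] , [])) (≋-sym (childPieces≋ l₁ l₂ l₃))))

    prec-identity : tensorOp _≺T_ (cutTerms x) (cutTerms l) ≋ cutTerms t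
    prec-identity =
      ≋-trans (tensorOp-cutTerms _≺T_ a [] leaf l₁ l₂ l₃)
      (≋-trans (≋-++⁺ totalCutRow (≋-concatMap⁺ _ prec-pieces))
               (≋-sym (cutTerms-node a [] l)))
      where
      totalCutRow : concatMap (tensOp _≺T_ (x , leaf)) (tensorTerms (rootPiece l ∷ nodePieces l₁ l₂ l₃)) ≋ (t , leaf) ∷ []
      totalCutRow =
        ≋-++⁺ (≋-refl {xs = (t , leaf) ∷ []})
              (totalCutRow-vanishes _≺T_ x (λ _ _ → refl) (nodePieces l₁ l₂ l₃) (nodePieces-isNode l₁ l₂ l₃))

  module _ (a₁ : Tree) (a₂ : List Tree) (a₃ : Tree) where
    private
      a t : Tree
      a = node a₁ a₂ a₃
      t = node a [] leaf

      graftLeft : Pieces → Pieces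
      graftLeft A = nodePiece A ([] , []) ([] , leaf)

    succ-pieces : nodePieces a [] leaf ≋ graftLeft (rootPiece a) ∷ productPieces _≻T_ (nodePieces a₁ a₂ a₃) (rootPiece Y ∷ nodePieces leaf [] leaf)
    succ-pieces =
      ≋-trans (≋-concatMap-cong (λ A → ≋-++-identityʳ (graftLeft A ∷ [])) (childPieces a))
      (≋-trans (≋-concatMap-singleton graftLeft (childPieces a))
      (≋-trans (≋-map⁺ graftLeft (childPieces≋ a₁ a₂ a₃))
      (≋-++⁺ (≋-refl {xs = graftLeft (rootPiece a) ∷ []})
             (≋-sym (≋-trans (≋-concatMap-cong-local (λ {A} → per-piece {A}) (nodePieces-isNode a₁ a₂ a₃))
                             (≋-concatMap-singleton graftLeft (nodePieces a₁ a₂ a₃)))))))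
      where
      per-piece : ∀ {A} → IsNode (proj₂ A) →
        concatMap (piecesOp _≻T_ A) (rootPiece Y ∷ nodePieces leaf [] leaf) ≋ graftLeft A ∷ []
      per-piece (isNode _ _ _) = ≋-refl

    succ-identity : tensorOp _≻T_ (cutTerms a) (cutTerms Y) ≋ cutTerms t
    succ-identity =
      ≋-trans (tensorOp-cutTerms _≻T_ a₁ a₂ a₃ leaf [] leaf)
      (≋-sym (≋-trans (cutTerms-node a [] leaf) (≋-++⁺ (≋-refl {xs = (t , leaf) ∷ []}) (≋-concatMap⁺ _ succ-pieces))))

  ∧-true : ∀ {x y} → x ∧ y ≡ true → x ≡ true × y ≡ true
  ∧-true {true} {true} _ = refl , refl

  mutual
    eqT-sound : ∀ x y → eqT x y ≡ true → x ≡ y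
    eqT-sound leaf         leaf            _ = refl
    eqT-sound (node a m l) (node a′ m′ l′) e with ∧-true {eqT a a′} e
    ... | e₁ , e₂ with ∧-true {eqTs m m′} e₂
    ... | e₃ , e₄ = cong₂ (λ f → f) (cong₂ node (eqT-sound a a′ e₁) (eqTs-sound m m′ e₃)) (eqT-sound l l′ e₄)

    eqTs-sound : ∀ xs ys → eqTs xs ys ≡ true → xs ≡ ys
    eqTs-sound []       []       _ = refl
    eqTs-sound (x ∷ xs) (y ∷ ys) e with ∧-true {eqT x y} e
    ... | e₁ , e₂ = cong₂ _∷_ (eqT-sound x y e₁) (eqTs-sound xs ys e₂)

  mutual
    eqT-refl : ∀ x → eqT x x ≡ true
    eqT-refl leaf         = refl
    eqT-refl (node a m l) rewrite eqT-refl a | eqTs-refl m | eqT-refl l = refl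

    eqTs-refl : ∀ xs → eqTs xs xs ≡ true
    eqTs-refl []       = refl
    eqTs-refl (x ∷ xs) rewrite eqT-refl x | eqTs-refl xs = refl

  eqT²-sound : ∀ a b a′ b′ → eqT a a′ ∧ eqT b b′ ≡ true → a ≡ a′ × b ≡ b′
  eqT²-sound a b a′ b′ e with ∧-true {eqT a a′} e
  ... | e₁ , e₂ = eqT-sound a a′ e₁ , eqT-sound b b′ e₂

  eqT²-refl : ∀ a b → eqT a a ∧ eqT b b ≡ true
  eqT²-refl a b rewrite eqT-refl a | eqT-refl b = refl

-- Formal linear combinations

module Coefficients {c ℓ : Level} (K : Field c ℓ) where

  open import Data.Bool using (true; false; _∧_; if_then_else_)
  open import Data.Nat as ℕ using (ℕ; zero; suc; s≤s)
  import Data.Nat.Properties as ℕₚ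
  open import Data.List using (List; []; _∷_; _++_; concatMap; length)
  open import Data.List.Properties using (map-++)
  open import Data.Product using (_×_; _,_)
  import Relation.Binary.PropositionalEquality as ≡
  open Field K renaming (Carrier to 𝕂) hiding (zero)
  open Linear K
  open import Relation.Binary.Bundles using (Setoid)
  open import Relation.Binary.Reasoning.Setoid setoid
  open CutSums using (Σℕ; _≋_; Σℕ-≡; eqT²-sound; eqT²-refl)

  ≈₂-sym : ∀ {u v} → u ≈₂ v → v ≈₂ u
  ≈₂-sym p a b = sym (p a b)

  ≈₂-trans : ∀ {u v w} → u ≈₂ v → v ≈₂ w → u ≈₂ w
  ≈₂-trans p q a b = trans (p a b) (q a b)

  ≈₂-setoid : Setoid c ℓ
  ≈₂-setoid = record
    { Carrier       = V₂
    ; _≈_           = _≈₂_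
    ; isEquivalence = record
      { refl  = λ a b → refl
      ; sym   = λ {u} {v} → ≈₂-sym {u} {v}
      ; trans = λ {u} {v} {w} → ≈₂-trans {u} {v} {w}
      }
    }

  ≈₂-swap : ∀ e₁ e₂ → (e₁ ∷ e₂ ∷ []) ≈₂ (e₂ ∷ e₁ ∷ [])
  ≈₂-swap e₁ e₂ a b = trans (sym (+-assoc _ _ _)) (trans (+-cong (+-comm _ _) refl) (+-assoc _ _ _))

  Σᴷ : ∀ {a} {A : Set a} → (A → 𝕂) → List A → 𝕂
  Σᴷ f []       = 0#
  Σᴷ f (x ∷ xs) = f x + Σᴷ f xs

  Σᴷ-cong : ∀ {a} {A : Set a} {f g : A → 𝕂} → (∀ x → f x ≈ g x) → ∀ xs → Σᴷ f xs ≈ Σᴷ g xs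
  Σᴷ-cong e []       = refl
  Σᴷ-cong e (x ∷ xs) = +-cong (e x) (Σᴷ-cong e xs)

  *-Σᴷ : ∀ {a} {A : Set a} r (f : A → 𝕂) xs → r * Σᴷ f xs ≈ Σᴷ (λ x → r * f x) xs
  *-Σᴷ r f []       = zeroʳ r
  *-Σᴷ r f (x ∷ xs) = trans (distribˡ r _ _) (+-cong refl (*-Σᴷ r f xs))

  coeff₂-++ : ∀ u u′ a b → coeff₂ (u ++ u′) a b ≈ coeff₂ u a b + coeff₂ u′ a b
  coeff₂-++ []      u′ a b = sym (+-identityˡ _)
  coeff₂-++ (e ∷ u) u′ a b = trans (+-cong refl (coeff₂-++ u u′ a b)) (sym (+-assoc _ _ _))

  coeff₂-concatMap : ∀ {a} {A : Set a} (g : A → V₂) xs b₁ b₂ →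
                     coeff₂ (concatMap g xs) b₁ b₂ ≈ Σᴷ (λ x → coeff₂ (g x) b₁ b₂) xs
  coeff₂-concatMap g []       b₁ b₂ = refl
  coeff₂-concatMap g (x ∷ xs) b₁ b₂ =
    trans (coeff₂-++ (g x) (concatMap g xs) b₁ b₂) (+-cong refl (coeff₂-concatMap g xs b₁ b₂))

  coeff₂-scale₂ : ∀ r u a b → coeff₂ (scale₂ r u) a b ≈ r * coeff₂ u a b
  coeff₂-scale₂ r []                    a b = sym (zeroʳ r)
  coeff₂-scale₂ r ((s , a′ , b′) ∷ u) a b =
    trans (+-cong (if-* (eqT a a′ ∧ eqT b b′)) (coeff₂-scale₂ r u a b)) (sym (distribˡ r _ _))
    where
    if-* : ∀ e → (if e then r * s else 0#) ≈ r * (if e then s else 0#)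
    if-* true  = refl
    if-* false = sym (zeroʳ r)

  linExt-single : ∀ δ t → linExt δ (lift (t ∷ [])) ≈₂ δ t
  linExt-single δ t a b =
    trans (coeff₂-++ (scale₂ 1# (δ t)) [] a b)
    (trans (+-identityʳ _) (trans (coeff₂-scale₂ 1# (δ t) a b) (*-identityˡ _)))

  pairing : V₂ → (Tree → Tree → 𝕂) → 𝕂
  pairing v h = Σᴷ (λ { (r , a , b) → r * h a b }) v

  pairing-congʳ : ∀ v {h h′ : Tree → Tree → 𝕂} → (∀ x y → h x y ≈ h′ x y) → pairing v h ≈ pairing v h′
  pairing-congʳ v e = Σᴷ-cong (λ { (r , a , b) → *-cong refl (e a b) }) v

  coeff₂-ext₂ : ∀ f v w a b →
    coeff₂ (ext₂ f v w) a b ≈ pairing v (λ x y → pairing w (λ x′ y′ → coeff₂ (lift₂ (f (x , y) (x′ , y′))) a b))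
  coeff₂-ext₂ f v w a b =
    trans (coeff₂-concatMap _ v a b) (Σᴷ-cong (λ { (r , x , y) → trans (coeff₂-concatMap _ w a b)
      (trans (Σᴷ-cong (λ { (s , x′ , y′) → trans (coeff₂-scale₂ (r * s) (lift₂ (f (x , y) (x′ , y′))) a b) (*-assoc _ _ _) }) w)
             (sym (*-Σᴷ r _ w))) }) v)

  removeKey : Tree → Tree → V₂ → V₂
  removeKey a b []                    = []
  removeKey a b ((r , a′ , b′) ∷ v) =
    if eqT a a′ ∧ eqT b b′ then removeKey a b v else (r , a′ , b′) ∷ removeKey a b v

  length-removeKey : ∀ a b v → length (removeKey a b v) ℕ.≤ length v
  length-removeKey a b []                    = ℕ.z≤n
  length-removeKey a b ((r , a′ , b′) ∷ v) with eqT a a′ ∧ eqT b b′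
  ... | true  = ℕₚ.m≤n⇒m≤1+n (length-removeKey a b v)
  ... | false = s≤s (length-removeKey a b v)

  removeKey-head : ∀ r a b v → removeKey a b ((r , a , b) ∷ v) ≡.≡ removeKey a b v
  removeKey-head r a b v rewrite eqT²-refl a b = ≡.refl

  -- Splitting off the coefficient of a ⊗ b is what makes pairing depend on v
  -- only through its coefficients.
  pairing-removeKey : ∀ a b h v → pairing v h ≈ coeff₂ v a b * h a b + pairing (removeKey a b v) h
  pairing-removeKey a b h [] = sym (trans (+-cong (zeroˡ _) refl) (+-identityˡ _))
  pairing-removeKey a b h ((r , a′ , b′) ∷ v) with eqT a a′ ∧ eqT b b′ in eq
  ... | true with eqT²-sound a b a′ b′ eq
  ...   | ≡.refl , ≡.refl = begin
          r * h a b + pairing v h                                         ≈⟨ +-cong refl (pairing-removeKey a b h v) ⟩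
          r * h a b + (coeff₂ v a b * h a b + pairing (removeKey a b v) h) ≈⟨ +-assoc _ _ _ ⟨
          (r * h a b + coeff₂ v a b * h a b) + pairing (removeKey a b v) h ≈⟨ +-cong (distribʳ (h a b) r _) refl ⟨
          (r + coeff₂ v a b) * h a b + pairing (removeKey a b v) h         ∎
  pairing-removeKey a b h ((r , a′ , b′) ∷ v) | false = begin
          r * h a′ b′ + pairing v h
            ≈⟨ +-cong refl (pairing-removeKey a b h v) ⟩
          r * h a′ b′ + (coeff₂ v a b * h a b + pairing (removeKey a b v) h)
            ≈⟨ x∙yz≈y∙xz _ _ _ ⟩
          coeff₂ v a b * h a b + (r * h a′ b′ + pairing (removeKey a b v) h)
            ≈⟨ +-cong (trans (+-cong (zeroˡ (h a b)) refl) (+-identityˡ _)) refl ⟨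
          (0# * h a b + coeff₂ v a b * h a b) + (r * h a′ b′ + pairing (removeKey a b v) h)
            ≈⟨ +-cong (distribʳ (h a b) 0# _) refl ⟨
          (0# + coeff₂ v a b) * h a b + (r * h a′ b′ + pairing (removeKey a b v) h) ∎
    where open import Algebra.Properties.CommutativeSemigroup +-commutativeSemigroup using (x∙yz≈y∙xz)

  coeff₂-removeKey-same : ∀ a b v → coeff₂ (removeKey a b v) a b ≈ 0#
  coeff₂-removeKey-same a b []                    = refl
  coeff₂-removeKey-same a b ((r , a′ , b′) ∷ v) with eqT a a′ ∧ eqT b b′ in eq
  ... | true  = coeff₂-removeKey-same a b v
  ... | false rewrite eq = trans (+-identityˡ _) (coeff₂-removeKey-same a b v)

  coeff₂-removeKey-other : ∀ a b v a₂ b₂ → eqT a₂ a ∧ eqT b₂ b ≡.≡ false →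
                           coeff₂ (removeKey a b v) a₂ b₂ ≈ coeff₂ v a₂ b₂
  coeff₂-removeKey-other a b []                    a₂ b₂ ne = refl
  coeff₂-removeKey-other a b ((r , a′ , b′) ∷ v) a₂ b₂ ne with eqT a a′ ∧ eqT b b′ in eq
  ... | false = +-cong refl (coeff₂-removeKey-other a b v a₂ b₂ ne)
  ... | true with eqT²-sound a b a′ b′ eq
  ...   | ≡.refl , ≡.refl rewrite ne = trans (coeff₂-removeKey-other a b v a₂ b₂ ne) (sym (+-identityˡ _))

  removeKey-cong : ∀ a b {v w} → v ≈₂ w → removeKey a b v ≈₂ removeKey a b w
  removeKey-cong a b {v} {w} e a₂ b₂ with eqT a₂ a ∧ eqT b₂ b in eq
  ... | false = trans (coeff₂-removeKey-other a b v a₂ b₂ eq) (trans (e a₂ b₂) (sym (coeff₂-removeKey-other a b w a₂ b₂ eq)))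
  ... | true with eqT²-sound a₂ b₂ a b eq
  ...   | ≡.refl , ≡.refl = trans (coeff₂-removeKey-same a b v) (sym (coeff₂-removeKey-same a b w))

  pairing-congˡ : ∀ h {v w} → v ≈₂ w → pairing v h ≈ pairing w h
  pairing-congˡ h {v} {w} = by-size (length v ℕ.+ length w) v w ℕₚ.≤-refl
    where
    step : ∀ a b {v w} → v ≈₂ w → pairing (removeKey a b v) h ≈ pairing (removeKey a b w) h → pairing v h ≈ pairing w h
    step a b {v} {w} e r =
      trans (pairing-removeKey a b h v) (trans (+-cong (*-cong (e a b) refl) r) (sym (pairing-removeKey a b h w)))
    by-size : ∀ n v w → length v ℕ.+ length w ℕ.≤ n → v ≈₂ w → pairing v h ≈ pairing w h
    by-size n       []                  []                  _        _ = refl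
    by-size (suc n) ((r , a , b) ∷ v) w                   (s≤s le) e =
      step a b {(r , a , b) ∷ v} {w} e (≡.subst (λ u → pairing u h ≈ pairing (removeKey a b w) h) (≡.sym (removeKey-head r a b v))
        (by-size n (removeKey a b v) (removeKey a b w)
           (ℕₚ.≤-trans (ℕₚ.+-mono-≤ (length-removeKey a b v) (length-removeKey a b w)) le)
           (≡.subst (λ u → u ≈₂ removeKey a b w) (removeKey-head r a b v) (removeKey-cong a b {(r , a , b) ∷ v} {w} e))))
    by-size (suc n) []                  ((r , a , b) ∷ w) le       e =
      step a b {[]} {(r , a , b) ∷ w} e (≡.subst (λ u → pairing [] h ≈ pairing u h) (≡.sym (removeKey-head r a b w))
        (by-size n [] (removeKey a b w) (ℕₚ.≤-trans (length-removeKey a b w) (ℕₚ.≤-pred le))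
           (≡.subst (λ u → [] ≈₂ u) (removeKey-head r a b w) (removeKey-cong a b {[]} {(r , a , b) ∷ w} e))))

  ext₂-cong : ∀ f {v v′ w w′} → v ≈₂ v′ → w ≈₂ w′ → ext₂ f v w ≈₂ ext₂ f v′ w′
  ext₂-cong f {v} {v′} {w} {w′} e₁ e₂ a b =
    trans (coeff₂-ext₂ f v w a b)
    (trans (pairing-congˡ (inner w) {v} {v′} e₁)
    (trans (pairing-congʳ v′ (λ x y → pairing-congˡ (λ x′ y′ → coeff₂ (lift₂ (f (x , y) (x′ , y′))) a b) {w} {w′} e₂))
           (sym (coeff₂-ext₂ f v′ w′ a b))))
    where
    inner : V₂ → Tree → Tree → 𝕂
    inner u x y = pairing u (λ x′ y′ → coeff₂ (lift₂ (f (x , y) (x′ , y′))) a b)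

  ι : ℕ → 𝕂
  ι zero    = 0#
  ι (suc n) = 1# + ι n

  ι-+ : ∀ m n → ι (m ℕ.+ n) ≈ ι m + ι n
  ι-+ zero    n = sym (+-identityˡ _)
  ι-+ (suc m) n = trans (+-cong refl (ι-+ m n)) (sym (+-assoc _ _ _))

  indicator : Tree → Tree → Tree × Tree → ℕ
  indicator a b (a′ , b′) = if eqT a a′ ∧ eqT b b′ then 1 else 0

  coeff₂-lift₂ : ∀ L a b → coeff₂ (lift₂ L) a b ≈ ι (Σℕ (indicator a b) L)
  coeff₂-lift₂ []              a b = refl
  coeff₂-lift₂ ((a′ , b′) ∷ L) a b =
    trans (+-cong (ι-indicator (eqT a a′ ∧ eqT b b′)) (coeff₂-lift₂ L a b)) (sym (ι-+ (indicator a b (a′ , b′)) _))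
    where
    ι-indicator : ∀ e → (if e then 1# else 0#) ≈ ι (if e then 1 else 0)
    ι-indicator true  = sym (+-identityʳ 1#)
    ι-indicator false = refl

  lift₂-cong : ∀ {L M} → L ≋ M → lift₂ L ≈₂ lift₂ M
  lift₂-cong {L} {M} e a b =
    trans (coeff₂-lift₂ L a b) (trans (reflexive (≡.cong ι (Σℕ-≡ e (indicator a b)))) (sym (coeff₂-lift₂ M a b)))

  pairing-lift₂ : ∀ L h → pairing (lift₂ L) h ≈ Σᴷ (λ { (x , y) → h x y }) L
  pairing-lift₂ []       h = refl
  pairing-lift₂ (p ∷ L) h = +-cong (*-identityˡ _) (pairing-lift₂ L h)

  coeff₂-lift₂-concatMap : ∀ {A : Set} (g : A → List (Tree × Tree)) L a b →
                           coeff₂ (lift₂ (concatMap g L)) a b ≈ Σᴷ (λ p → coeff₂ (lift₂ (g p)) a b) L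
  coeff₂-lift₂-concatMap g []      a b = refl
  coeff₂-lift₂-concatMap g (x ∷ L) a b =
    trans (reflexive (≡.cong (λ z → coeff₂ z a b) (map-++ _ (g x) (concatMap g L))))
          (trans (coeff₂-++ (lift₂ (g x)) _ a b) (+-cong refl (coeff₂-lift₂-concatMap g L a b)))

  ext₂-lift₂ : ∀ op L M → ext₂ (tensOp op) (lift₂ L) (lift₂ M) ≈₂ lift₂ (CutSums.tensorOp op L M)
  ext₂-lift₂ op L M a b =
    trans (coeff₂-ext₂ (tensOp op) (lift₂ L) (lift₂ M) a b)
    (trans (pairing-lift₂ L _)
    (trans (Σᴷ-cong (λ p → pairing-lift₂ M _) L)
           (sym (trans (coeff₂-lift₂-concatMap _ L a b) (Σᴷ-cong (λ p → coeff₂-lift₂-concatMap _ M a b) L)))))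

module Size where

  open import Data.Nat using (ℕ; suc; _+_; _≤_; _<_; z≤n; s≤s)
  open import Data.Nat.Properties using (≤-trans; m≤m+n; m≤n+m; +-mono-≤; +-monoʳ-≤; +-monoˡ-≤)
  open import Data.Nat.Solver using (module +-*-Solver)
  open +-*-Solver using (solve; _:=_; _:+_; con)
  open import Data.List using (List; []; _∷_)
  open import Relation.Binary.PropositionalEquality using (refl; sym; subst; subst₂)

  mutual
    size : Tree → ℕ
    size leaf         = 1
    size (node a m l) = suc (size a + sizes m + size l)

    sizes : List Tree → ℕ
    sizes []       = 0
    sizes (x ∷ xs) = size x + sizes xs

  1≤size : ∀ t → 1 ≤ size t
  1≤size leaf         = s≤s z≤n
  1≤size (node _ _ _) = s≤s z≤n

  2≤size-node : ∀ a m l → 2 ≤ size (node a m l)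
  2≤size-node a m l = s≤s (≤-trans (1≤size a) (≤-trans (m≤m+n (size a) (sizes m)) (m≤m+n (size a + sizes m) (size l))))

  private
    regroup : ∀ A M S L → A + (M + S) + L ≡ A + M + (S + L)
    regroup = solve 4 (λ A M S L → A :+ (M :+ S) :+ L := A :+ M :+ (S :+ L)) refl

  dot-left< : ∀ A M S L → 1 ≤ L → suc (A + 0 + M) < suc (A + (M + S) + L)
  dot-left< A M S L 1≤L = s≤s (subst₂ _≤_ (sym (solve 2 (λ A M → con 1 :+ (A :+ con 0 :+ M) := A :+ M :+ con 1) refl A M))
                                           (sym (regroup A M S L))
                                           (+-monoʳ-≤ (A + M) (≤-trans 1≤L (m≤n+m L S))))

  dot-right< : ∀ A M S L → 1 ≤ A → 1 ≤ M → suc (1 + S + L) < suc (A + (M + S) + L)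
  dot-right< A M S L 1≤A 1≤M = s≤s (subst (2 + (S + L) ≤_) (sym (regroup A M S L)) (+-monoˡ-≤ (S + L) (+-mono-≤ 1≤A 1≤M)))

  prec-left< : ∀ A L → 2 ≤ L → suc (A + 0 + 1) < suc (A + 0 + L)
  prec-left< A L 2≤L = s≤s (subst (_≤ A + 0 + L) (sym (solve 1 (λ A → con 1 :+ (A :+ con 0 :+ con 1) := A :+ con 0 :+ con 2) refl A))
                                  (+-monoʳ-≤ (A + 0) 2≤L))

  prec-right< : ∀ A L → L < suc (A + 0 + L)
  prec-right< A L = s≤s (m≤n+m L (A + 0))

  succ-left< : ∀ A → A < suc (A + 0 + 1)
  succ-left< A = s≤s (≤-trans (m≤m+n A 0) (m≤m+n (A + 0) 1))

module Agreement {c ℓ : Level} (K : Field c ℓ) (δ : Tree → Linear.V₂ K) (H : Linear.IsCoproductMorphism K δ) where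

  open import Data.Nat using (suc; _≤_)
  open import Data.Nat.Properties using (≤-trans; ≤-pred)
  open import Data.List using ([]; _∷_)
  open import Data.Product using (_,_)
  open import Data.Empty using (⊥-elim)
  open import Relation.Binary.PropositionalEquality using (refl; subst)
  open Linear K
  open Coefficients K
  open IsCoproductMorphism H
  open CutSums using (_≋_; tensorOp; *T-identityʳ; dot-identity; prec-identity; succ-identity)
  open Size

  agreement-step : ∀ op x y t → linExt δ (lift (op x y)) ≈₂ ext₂ (tensOp op) (δ x) (δ y) → op x y ≡ t ∷ [] →
                   δ x ≈₂ cutSum x → δ y ≈₂ cutSum y → tensorOp op (cutTerms x) (cutTerms y) ≋ cutTerms t →
                   δ t ≈₂ cutSum t
  agreement-step op x y t pres op≡t δx δy identity = begin
    δ t                                                  ≈⟨ linExt-single δ t ⟨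
    linExt δ (lift (t ∷ []))                             ≈⟨ subst (λ ts → linExt δ (lift ts) ≈₂ ext₂ (tensOp op) (δ x) (δ y)) op≡t pres ⟩
    ext₂ (tensOp op) (δ x) (δ y)                         ≈⟨ ext₂-cong (tensOp op) {δ x} {cutSum x} {δ y} {cutSum y} δx δy ⟩
    ext₂ (tensOp op) (cutSum x) (cutSum y)               ≈⟨ ext₂-lift₂ op (cutTerms x) (cutTerms y) ⟩
    lift₂ (tensorOp op (cutTerms x) (cutTerms y))        ≈⟨ lift₂-cong identity ⟩
    cutSum t                                             ∎
    where open import Relation.Binary.Reasoning.Setoid ≈₂-setoid

  δY : δ Y ≈₂ cutSum Y
  δY = ≈₂-trans {δ Y} {(1# , Y , leaf) ∷ (1# , leaf , Y) ∷ []} {cutSum Y} onY (≈₂-swap (1# , Y , leaf) (1# , leaf , Y))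
    where open Field K using (1#)

  agreement : ∀ n t → size t ≤ n → ¬ (t ≡ leaf) → δ t ≈₂ cutSum t
  agreement n       leaf _ t≢| = ⊥-elim (t≢| refl)
  agreement (suc n) (node a (m₁ ∷ ms) l) size≤ _ =
    agreement-step _·T_ x y t (pres-· x y (λ ()) (λ ())) x·y≡t
      (agreement n x (≤-pred (≤-trans (dot-left< (size a) (size m₁) (sizes ms) (size l) (1≤size l)) size≤)) (λ ()))
      (agreement n y (≤-pred (≤-trans (dot-right< (size a) (size m₁) (sizes ms) (size l) (1≤size a) (1≤size m₁)) size≤)) (λ ()))
      (dot-identity a m₁ ms l)
    where
    x y t : Tree
    x = node a [] m₁
    y = node leaf ms l
    t = node a (m₁ ∷ ms) l
    x·y≡t : x ·T y ≡ t ∷ []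
    x·y≡t rewrite *T-identityʳ m₁ = refl
  agreement (suc n) (node a [] (node l₁ l₂ l₃)) size≤ _ =
    agreement-step _≺T_ x l (node a [] l) (pres-≺ x l (λ ()) (λ ())) refl
      (agreement n x (≤-pred (≤-trans (prec-left< (size a) (size l) (2≤size-node l₁ l₂ l₃)) size≤)) (λ ()))
      (agreement n l (≤-pred (≤-trans (prec-right< (size a) (size l)) size≤)) (λ ()))
      (prec-identity a l₁ l₂ l₃)
    where
    x l : Tree
    x = node a [] leaf
    l = node l₁ l₂ l₃
  agreement (suc n) (node (node a₁ a₂ a₃) [] leaf) size≤ _ =
    agreement-step _≻T_ a Y (node a [] leaf) (pres-≻ a Y (λ ()) (λ ())) refl
      (agreement n a (≤-pred (≤-trans (succ-left< (size a)) size≤)) (λ ()))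
      δY
      (succ-identity a₁ a₂ a₃)
    where
    a : Tree
    a = node a₁ a₂ a₃
  agreement (suc n) (node leaf [] leaf) _ _ = δY

mainTheorem6 : ∀ {c ℓ : Level} (K : Field c ℓ) (δ : Tree → Linear.V₂ K) →
               Linear.IsCoproductMorphism K δ →
               ∀ (t : Tree) → ¬ (t ≡ leaf) →
               Linear._≈₂_ K (δ t) (Linear.cutSum K t)
mainTheorem6 K δ H t = Agreement.agreement K δ H (Size.size t) t ≤-refl
  where open import Data.Nat.Properties using (≤-refl)
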